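{- Let $k,n$ be positive integers, $m=(n-1)k+1$, let $\mathcal{I}$ be the set of partitions of $\{1,\dots,m\}$ with exactly one block of size larger than $1$, and let $\mathcal{G}=\{x\in\mathcal{I}\mid \mathrm{rk}(x)\equiv 0 \pmod k\}$. There is a bijective correspondence between the simplicial complex $\mathcal{T}^k_n$ and the family of sets $\{N\in\mathcal{N}(\Pi_m,\mathcal{I})\mid N\subseteq \mathcal{G}\}$. In particular, the latter family is a simplicial complex.
   Context: $\Pi_m$ is the lattice of set partitions of $\{1,\dots,m\}$ ordered by refinement, with join $\vee$; $\mathrm{rk}(x)=m-(\text{number of blocks of }x)$, so for $x\in\mathcal{I}$ with non-singleton block $S$, $\mathrm{rk}(x)=|S|-1$. A subset $N\subseteq\mathcal{I}$ is $\mathcal{I}$-nested if for every set $\{x_1,\dots,x_\ell\}\subseteq N$ ($\ell\ge2$) of pairwise incomparable elements, the join $x_1\vee\dots\vee x_\ell$ is not in $\mathcal{I}$. The nested set complex $\mathcal{N}(\Pi_m,\mathcal{I})$ is the abstract simplicial complex of all nonempty $\mathcal{I}$-nested sets not containing the maximal element of $\Pi_m$. The complex of $k$-trees $\mathcal{T}^k_n$ is the abstract simplicial complex whose faces are combinatorial types of rooted trees with $m$ leaves labelled $1,\dots,m$ in which every internal vertex has outdegree larger than $1$ and congruent to $1$ modulo $k$; $T_2$ is a face of $T_1$ iff $T_2$ is obtained from $T_1$ by contracting a set of internal edges. -}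

module Defs where

open import Data.Nat using (ℕ; zero; suc; _+_; _*_; _∸_; _<_; _≤_; _<ᵇ_)
open import Data.Nat.Divisibility using (_∣_)
open import Data.Bool using (Bool; true; false; not; _∧_)
open import Data.Fin using (Fin; toℕ)
open import Data.Fin.Subset using (Subset; ∣_∣)
open import Data.Vec using (Vec; lookup; replicate)
open import Data.List using (List; []; _∷_; _++_; length; allFin; filterᵇ)
open import Data.Bool.ListAction using (any)
open import Data.List.Membership.Propositional using (_∈_)
open import Data.List.Relation.Unary.AllPairs using (AllPairs)
open import Data.List.Relation.Binary.Permutation.Propositional using (_↭_)
import Data.List.Relation.Binary.Permutation.Homogeneous as PermH
open import Relation.Binary.Construct.Closure.ReflexiveTransitive using (Star)
open import Relation.Binary.PropositionalEquality using (_≡_)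
open import Relation.Nullary using (¬_)
open import Data.Product using (Σ; ∃; ∃-syntax; _×_; _,_; proj₁)
open import Data.Unit using (⊤)

-- Set partitions of {1,…,m} (encoded as Fin m), via their equivalence
-- relation written as an m×m Boolean matrix: row i is the block of i.

Matrix : ℕ → Set
Matrix m = Vec (Subset m) m

rel : ∀ {m} → Matrix m → Fin m → Fin m → Bool
rel M i j = lookup (lookup M i) j

IsPartition : ∀ {m} → Matrix m → Set
IsPartition {m} M =
  (∀ i → rel M i i ≡ true) ×
  (∀ i j → rel M i j ≡ true → rel M j i ≡ true) ×
  (∀ i j l → rel M i j ≡ true → rel M j l ≡ true → rel M i l ≡ true)

_≤Π_ : ∀ {m} → Matrix m → Matrix m → Set
x ≤Π y = ∀ i j → rel x i j ≡ true → rel y i j ≡ true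

top : ∀ m → Matrix m
top m = replicate m (replicate m true)

block : ∀ {m} → Matrix m → Fin m → Subset m
block M i = lookup M i

-- number of blocks = number of elements that are the least element of their block
isLeastInBlock : ∀ {m} → Matrix m → Fin m → Bool
isLeastInBlock {m} M i = not (any (λ j → (toℕ j <ᵇ toℕ i) ∧ rel M i j) (allFin m))

numBlocks : ∀ {m} → Matrix m → ℕ
numBlocks {m} M = length (filterᵇ (isLeastInBlock M) (allFin m))

rk : ∀ {m} → Matrix m → ℕ
rk {m} M = m ∸ numBlocks M

InI : ∀ {m} → Matrix m → Set
InI M = IsPartition M ×
  (∃[ i ] 1 < ∣ block M i ∣) ×
  (∀ i i' → 1 < ∣ block M i ∣ → 1 < ∣ block M i' ∣ → block M i ≡ block M i')

InG : ∀ {m} → ℕ → Matrix m → Set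
InG k M = InI M × (k ∣ rk M)

IsJoin : ∀ {m} → List (Matrix m) → Matrix m → Set
IsJoin {m} xs z = IsPartition z × (∀ {x} → x ∈ xs → x ≤Π z) ×
  (∀ z' → IsPartition z' → (∀ {x} → x ∈ xs → x ≤Π z') → z ≤Π z')

-- finite sets of partitions are lists, compared by membership
_⊆ₛ_ : ∀ {A : Set} → List A → List A → Set
xs ⊆ₛ ys = ∀ {x} → x ∈ xs → x ∈ ys

_≋ₛ_ : ∀ {A : Set} → List A → List A → Set
xs ≋ₛ ys = xs ⊆ₛ ys × ys ⊆ₛ xs

Incomparable : ∀ {m} → Matrix m → Matrix m → Set
Incomparable x y = ¬ (x ≤Π y) × ¬ (y ≤Π x)

INested : ∀ {m} → List (Matrix m) → Set
INested {m} N = (∀ {x} → x ∈ N → InI x) ×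
  (∀ (xs : List (Matrix m)) → xs ⊆ₛ N → 2 ≤ length xs →
     AllPairs Incomparable xs → ∀ z → IsJoin xs z → ¬ InI z)

-- faces of 𝓝(Π_m, 𝓘) (together with the empty face), i.e. 𝓘-nested sets
-- not containing the maximal element
NestedFace : ∀ {m} → List (Matrix m) → Set
NestedFace {m} N = INested N × ¬ (top m ∈ N)

GFamily : ∀ (k : ℕ) {m} → List (Matrix m) → Set
GFamily k N = NestedFace N × (∀ {x} → x ∈ N → InG k x)

data Tree (m : ℕ) : Set where
  leaf : Fin m → Tree m
  node : List (Tree m) → Tree m

mutual
  leaves : ∀ {m} → Tree m → List (Fin m)
  leaves (leaf i) = i ∷ []
  leaves (node ts) = leavesL ts

  leavesL : ∀ {m} → List (Tree m) → List (Fin m)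
  leavesL [] = []
  leavesL (t ∷ ts) = leaves t ++ leavesL ts

mutual
  DegOK : ℕ → ∀ {m} → Tree m → Set
  DegOK k (leaf _) = ⊤
  DegOK k (node ts) = 1 < length ts × k ∣ (length ts ∸ 1) × DegOKL k ts

  DegOKL : ℕ → ∀ {m} → List (Tree m) → Set
  DegOKL k [] = ⊤
  DegOKL k (t ∷ ts) = DegOK k t × DegOKL k ts

IsKTree : ℕ → (m : ℕ) → Tree m → Set
IsKTree k m t = (leaves t ↭ allFin m) × DegOK k t

KTree : ℕ → ℕ → Set
KTree k m = Σ (Tree m) (IsKTree k m)

-- isomorphism of rooted trees (same combinatorial type): children may be
-- reordered, recursively
data _≅_ {m : ℕ} : Tree m → Tree m → Set where
  leaf : ∀ i → leaf i ≅ leaf i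
  node : ∀ {ts ss} → PermH.Permutation _≅_ ts ss → node ts ≅ node ss

data _⇝_ {m : ℕ} : Tree m → Tree m → Set where
  here  : ∀ as cs bs → node (as ++ node cs ∷ bs) ⇝ node (as ++ cs ++ bs)
  there : ∀ as bs {t t'} → t ⇝ t' → node (as ++ t ∷ bs) ⇝ node (as ++ t' ∷ bs)

IsFace : ∀ {m} → Tree m → Tree m → Set
IsFace t₂ t₁ = ∃[ t ] (Star _⇝_ t₁ t × t ≅ t₂)

-- A rooted tree with leaves 1, …, m is determined up to isomorphism by its clusters, the leaf sets
-- of its non-root internal vertices; they form a laminar family of proper subsets with at least two
-- elements.  A k-tree is sent to the partitions whose only non-singleton block is one of its
-- clusters.  Every subtree of a k-tree has ≡ 1 (mod k) leaves, so these partitions have rank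
-- divisible by k.  For single-block partitions, being 𝓘-nested is the same as laminarity: two
-- overlapping, non-nested blocks S and T have the single-block join S ∪ T ∈ 𝓘, whereas pairwise
-- incomparable members of a laminar family have disjoint blocks, so their join has at least two
-- non-singleton blocks.  Contracting an internal edge deletes exactly one cluster, so faces
-- correspond to subfamilies, and every laminar family of blocks of size ≡ 1 (mod k) is realised by
-- inserting its blocks one at a time into the star tree.

module Submission where

open import Defs
open import Data.Nat as ℕ using (ℕ; zero; suc; _+_; _*_; _∸_; _≤_; _<_; z≤n; s≤s)
import Data.Nat.Properties as ℕP
open import Data.Nat.Divisibility using (_∣_; _∣0; n∣m*n; ∣m∣n⇒∣m+n; ∣m+n∣m⇒∣n)
open import Data.Bool as Bool using (Bool; true; false; not; T; T?; _∧_; _∨_)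
import Data.Bool.Properties as BoolP
open import Data.Bool.ListAction using (any; or)
open import Data.Fin as Fin using (Fin; zero; suc; toℕ)
import Data.Fin.Properties as FinP
open import Data.Fin.Subset using (Subset; ∣_∣; _∪_)
open import Data.Fin.Subset.Properties using (∣p∣≤n)
open import Data.Vec as Vec using (Vec; lookup; tabulate; replicate; _[_]≔_)
import Data.Vec.Properties as VecP
open import Data.List as List using (List; []; _∷_; _++_; length; allFin; filterᵇ)
import Data.List.Properties as ListP
open import Data.List.Membership.Propositional using (_∈_)
import Data.List.Membership.Propositional.Properties as ∈P
import Data.List.Membership.DecPropositional as DecMembership
import Data.List.Relation.Binary.Subset.Propositional.Properties as ⊆P
open import Data.List.Relation.Unary.Any as Any using (here; there)
open import Data.List.Relation.Unary.Any.Properties using (¬Any[])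
open import Data.List.Relation.Unary.All as All using (All; []; _∷_)
import Data.List.Relation.Unary.All.Properties as AllP
open import Data.List.Relation.Unary.AllPairs using (AllPairs; []; _∷_)
import Data.List.Relation.Unary.AllPairs.Properties as AllPairsP
open import Data.List.Relation.Unary.Unique.Propositional using (Unique)
import Data.List.Relation.Unary.Unique.Propositional.Properties as UniqueP
open import Data.List.Relation.Binary.Permutation.Propositional as ↭ using (_↭_; ↭-sym; ↭-trans; ↭-refl)
import Data.List.Relation.Binary.Permutation.Propositional.Properties as ↭P
import Data.List.Relation.Binary.Permutation.Setoid.Properties as ↭ₛP
import Data.List.Relation.Binary.Permutation.Homogeneous as PermH
open import Data.List.Relation.Binary.Pointwise.Base using (Pointwise; []; _∷_)
open import Relation.Binary.Construct.Closure.ReflexiveTransitive using (Star; ε; _◅_; _◅◅_)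
import Relation.Binary.PropositionalEquality as ≡
open import Relation.Binary.PropositionalEquality using (_≡_; _≢_; refl; sym; trans; cong; cong₂; subst; subst₂)
open import Relation.Nullary using (¬_; Dec; yes; no; contradiction)
open import Relation.Nullary.Decidable using (⌊_⌋; _×-dec_; _→-dec_; ¬?; decidable-stable)
open import Data.Empty using (⊥; ⊥-elim)
open import Data.Product using (Σ; ∃-syntax; _×_; _,_; proj₁; proj₂)
open import Data.Sum using (_⊎_; inj₁; inj₂)
open import Data.Unit using (⊤; tt)
open import Function using (_∘_; id)
open import Function.Bundles using (_⇔_; mk⇔; Equivalence)

true≢false : true ≢ false
true≢false ()

∨≡true⁻ : ∀ {a b : Bool} → a ∨ b ≡ true → a ≡ true ⊎ b ≡ true
∨≡true⁻ {true} _ = inj₁ refl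
∨≡true⁻ {false} e = inj₂ e

∧≡false⁻ : ∀ {a b : Bool} → a ∧ b ≡ false → a ≡ false ⊎ b ≡ false
∧≡false⁻ {false} _ = inj₁ refl
∧≡false⁻ {true} e = inj₂ e

witness⌊⌋ : ∀ {P : Set} (P? : Dec P) → ⌊ P? ⌋ ≡ true → P
witness⌊⌋ (yes p) _ = p

refute⌊⌋ : ∀ {P : Set} (P? : Dec P) → ⌊ P? ⌋ ≡ false → ¬ P
refute⌊⌋ (no ¬p) _ = ¬p

⌊⌋≡true : ∀ {P : Set} (P? : Dec P) → P → ⌊ P? ⌋ ≡ true
⌊⌋≡true (yes _) _ = refl
⌊⌋≡true (no ¬p) p = contradiction p ¬p

any⁻ : ∀ {A : Set} (p : A → Bool) xs → any p xs ≡ true → ∃[ x ] (x ∈ xs × p x ≡ true)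
any⁻ p (x ∷ xs) e with ∨≡true⁻ {p x} e
... | inj₁ px = x , here refl , px
... | inj₂ rest with any⁻ p xs rest
... | y , y∈ , py = y , there y∈ , py

any⁺ : ∀ {A : Set} (p : A → Bool) {xs x} → x ∈ xs → p x ≡ true → any p xs ≡ true
any⁺ p {y ∷ xs} (here refl) px rewrite px = refl
any⁺ p {y ∷ xs} (there x∈) px rewrite any⁺ p x∈ px = BoolP.∨-zeroʳ (p y)

infix 4 _∈S_ _⊆S_

_∈S_ : ∀ {m} → Fin m → Subset m → Set
i ∈S S = lookup S i ≡ true

_⊆S_ : ∀ {m} → Subset m → Subset m → Set
S ⊆S T = ∀ i → i ∈S S → i ∈S T

Intersect : ∀ {m} → Subset m → Subset m → Set
Intersect S T = ∃[ i ] (i ∈S S × i ∈S T)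

module _ {m : ℕ} where

  infix 4 _∈S?_ _⊆S?_ _≟S_

  _∈S?_ : (i : Fin m) (S : Subset m) → Dec (i ∈S S)
  i ∈S? S = lookup S i Bool.≟ true

  _⊆S?_ : (S T : Subset m) → Dec (S ⊆S T)
  S ⊆S? T = FinP.all? (λ i → (i ∈S? S) →-dec (i ∈S? T))

  _≟S_ : (S T : Subset m) → Dec (S ≡ T)
  _≟S_ = VecP.≡-dec Bool._≟_

  ⊈S⇒∃ : ∀ {S T : Subset m} → ¬ (S ⊆S T) → ∃[ i ] (i ∈S S × ¬ i ∈S T)
  ⊈S⇒∃ {S} {T} S⊈T = decidable-stable (FinP.any? (λ i → (i ∈S? S) ×-dec ¬? (i ∈S? T)))
    λ none → S⊈T λ i i∈S → decidable-stable (i ∈S? T) λ i∉T → none (i , i∈S , i∉T)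

⊆S-antisym : ∀ {m} {S T : Subset m} → S ⊆S T → T ⊆S S → S ≡ T
⊆S-antisym {S = Vec.[]} {Vec.[]} _ _ = refl
⊆S-antisym {S = a Vec.∷ S} {b Vec.∷ T} S⊆T T⊆S =
  cong₂ Vec._∷_ (BoolP.⇔→≡ {z = true} (mk⇔ (S⊆T zero) (T⊆S zero)))
                (⊆S-antisym (S⊆T ∘ suc) (T⊆S ∘ suc))

∣∣-mono-⊆S : ∀ {m} {S T : Subset m} → S ⊆S T → ∣ S ∣ ≤ ∣ T ∣
∣∣-mono-⊆S {S = Vec.[]} {Vec.[]} _ = z≤n
∣∣-mono-⊆S {S = false Vec.∷ S} {false Vec.∷ T} S⊆T = ∣∣-mono-⊆S {S = S} {T} (S⊆T ∘ suc)
∣∣-mono-⊆S {S = false Vec.∷ S} {true Vec.∷ T} S⊆T = ℕP.m≤n⇒m≤1+n (∣∣-mono-⊆S {S = S} {T} (S⊆T ∘ suc))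
∣∣-mono-⊆S {S = true Vec.∷ S} {false Vec.∷ T} S⊆T with () ← S⊆T zero refl
∣∣-mono-⊆S {S = true Vec.∷ S} {true Vec.∷ T} S⊆T = s≤s (∣∣-mono-⊆S {S = S} {T} (S⊆T ∘ suc))

∈S⇒1≤∣∣ : ∀ {m} {S : Subset m} {i} → i ∈S S → 1 ≤ ∣ S ∣
∈S⇒1≤∣∣ {S = true Vec.∷ S} {zero} _ = s≤s z≤n
∈S⇒1≤∣∣ {S = true Vec.∷ S} {suc i} _ = s≤s z≤n
∈S⇒1≤∣∣ {S = false Vec.∷ S} {suc i} i∈S = ∈S⇒1≤∣∣ {S = S} i∈S

distinct-∈S⇒2≤∣∣ : ∀ {m} {S : Subset m} {i j} → i ∈S S → j ∈S S → i ≢ j → 2 ≤ ∣ S ∣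
distinct-∈S⇒2≤∣∣ {S = true Vec.∷ S} {zero} {zero} _ _ i≢j = contradiction refl i≢j
distinct-∈S⇒2≤∣∣ {S = true Vec.∷ S} {zero} {suc j} _ j∈S _ = s≤s (∈S⇒1≤∣∣ {S = S} j∈S)
distinct-∈S⇒2≤∣∣ {S = true Vec.∷ S} {suc i} {zero} i∈S _ _ = s≤s (∈S⇒1≤∣∣ {S = S} i∈S)
distinct-∈S⇒2≤∣∣ {S = true Vec.∷ S} {suc i} {suc j} i∈S j∈S i≢j =
  ℕP.m≤n⇒m≤1+n (distinct-∈S⇒2≤∣∣ {S = S} i∈S j∈S (i≢j ∘ cong suc))
distinct-∈S⇒2≤∣∣ {S = false Vec.∷ S} {suc i} {suc j} i∈S j∈S i≢j =
  distinct-∈S⇒2≤∣∣ {S = S} i∈S j∈S (i≢j ∘ cong suc)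

1≤∣∣⇒∃∈S : ∀ {m} {S : Subset m} → 1 ≤ ∣ S ∣ → ∃[ i ] (i ∈S S)
1≤∣∣⇒∃∈S {S = true Vec.∷ S} _ = zero , refl
1≤∣∣⇒∃∈S {S = false Vec.∷ S} 1≤∣S∣ with i , i∈S ← 1≤∣∣⇒∃∈S {S = S} 1≤∣S∣ = suc i , i∈S

2≤∣∣⇒∃∈S : ∀ {m} {S : Subset m} → 2 ≤ ∣ S ∣ → ∃[ i ] (i ∈S S)
2≤∣∣⇒∃∈S {S = S} 2≤∣S∣ = 1≤∣∣⇒∃∈S {S = S} (ℕP.≤-trans (s≤s z≤n) 2≤∣S∣)

2≤∣∣⇒∃-other : ∀ {m} {S : Subset m} → 2 ≤ ∣ S ∣ → ∀ i → ∃[ j ] (j ∈S S × j ≢ i)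
2≤∣∣⇒∃-other {S = false Vec.∷ S} 2≤∣S∣ zero with j , j∈S ← 2≤∣∣⇒∃∈S {S = S} 2≤∣S∣ = suc j , j∈S , λ ()
2≤∣∣⇒∃-other {S = false Vec.∷ S} 2≤∣S∣ (suc i) with j , j∈S , j≢i ← 2≤∣∣⇒∃-other {S = S} 2≤∣S∣ i =
  suc j , j∈S , j≢i ∘ FinP.suc-injective
2≤∣∣⇒∃-other {S = true Vec.∷ S} (s≤s 1≤∣S∣) zero with j , j∈S ← 1≤∣∣⇒∃∈S {S = S} 1≤∣S∣ =
  suc j , j∈S , λ ()
2≤∣∣⇒∃-other {S = true Vec.∷ S} _ (suc i) = zero , refl , λ ()

⊆-singleton⇒∣∣≤1 : ∀ {m} {S : Subset m} i → (∀ j → j ∈S S → j ≡ i) → ∣ S ∣ ≤ 1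
⊆-singleton⇒∣∣≤1 {S = S} i only-i with ∣ S ∣ ℕ.≤? 1
... | yes ∣S∣≤1 = ∣S∣≤1
... | no ∣S∣≰1 with j , j∈S , j≢i ← 2≤∣∣⇒∃-other {S = S} (ℕP.≰⇒> ∣S∣≰1) i = contradiction (only-i j j∈S) j≢i

∣∣-remove : ∀ {m} (S : Subset m) i → i ∈S S → ∣ S ∣ ≡ suc ∣ S [ i ]≔ false ∣
∣∣-remove (true Vec.∷ S) zero _ = refl
∣∣-remove (false Vec.∷ S) (suc i) i∈S = ∣∣-remove S i i∈S
∣∣-remove (true Vec.∷ S) (suc i) i∈S = cong suc (∣∣-remove S i i∈S)

empty⇒∣∣≡0 : ∀ {m} {S : Subset m} → (∀ i → ¬ i ∈S S) → ∣ S ∣ ≡ 0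
empty⇒∣∣≡0 {S = Vec.[]} _ = refl
empty⇒∣∣≡0 {S = true Vec.∷ S} empty = contradiction refl (empty zero)
empty⇒∣∣≡0 {S = false Vec.∷ S} empty = empty⇒∣∣≡0 {S = S} (empty ∘ suc)

length≡∣∣ : ∀ {m} {xs : List (Fin m)} {S : Subset m} → Unique xs →
            (∀ i → i ∈ xs → i ∈S S) → (∀ i → i ∈S S → i ∈ xs) → length xs ≡ ∣ S ∣
length≡∣∣ {xs = []} {S} _ _ S⊆xs = sym (empty⇒∣∣≡0 {S = S} (λ i i∈S → ¬Any[] (S⊆xs i i∈S)))
length≡∣∣ {xs = x ∷ xs} {S} (x∉xs ∷ uxs) xs⊆S S⊆xs =
  trans (cong suc (length≡∣∣ {xs = xs} {S = S [ x ]≔ false} uxs xs⊆S′ S′⊆xs))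
        (sym (∣∣-remove S x (xs⊆S x (here refl))))
  where
  xs⊆S′ : ∀ i → i ∈ xs → i ∈S (S [ x ]≔ false)
  xs⊆S′ i i∈xs = trans (VecP.lookup∘update′ (λ i≡x → All.lookup x∉xs i∈xs (sym i≡x)) S false) (xs⊆S i (there i∈xs))
  S′⊆xs : ∀ i → i ∈S (S [ x ]≔ false) → i ∈ xs
  S′⊆xs i i∈S′ with i Fin.≟ x
  ... | yes refl = contradiction (trans (sym i∈S′) (VecP.lookup∘update i S false)) true≢false
  ... | no i≢x with S⊆xs i (trans (sym (VecP.lookup∘update′ i≢x S false)) i∈S′)
  ...   | here i≡x = contradiction i≡x i≢x
  ...   | there i∈xs = i∈xs

module _ {A : Set} where

  Unique-resp-↭ : ∀ {xs ys : List A} → xs ↭ ys → Unique xs → Unique ys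
  Unique-resp-↭ xs↭ys = ↭ₛP.Unique-resp-↭ (≡.setoid A) (↭.↭⇒↭ₛ xs↭ys)

  Unique-++⁻ˡ : ∀ (xs : List A) {ys} → Unique (xs ++ ys) → Unique xs
  Unique-++⁻ˡ [] _ = []
  Unique-++⁻ˡ (x ∷ xs) (x∉ ∷ u) = AllP.++⁻ˡ xs x∉ ∷ Unique-++⁻ˡ xs u

  Unique-++⁻ʳ : ∀ (xs : List A) {ys} → Unique (xs ++ ys) → Unique ys
  Unique-++⁻ʳ [] u = u
  Unique-++⁻ʳ (x ∷ xs) (_ ∷ u) = Unique-++⁻ʳ xs u

  Unique-++⇒disjoint : ∀ (xs : List A) {ys x} → Unique (xs ++ ys) → x ∈ xs → ¬ x ∈ ys
  Unique-++⇒disjoint (_ ∷ xs) (x∉ ∷ _) (here refl) x∈ys = All.lookup (AllP.++⁻ʳ xs x∉) x∈ys refl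
  Unique-++⇒disjoint (_ ∷ xs) (_ ∷ u) (there x∈xs) = Unique-++⇒disjoint xs u x∈xs

  ∈⇒1≤length : ∀ {xs : List A} {x} → x ∈ xs → 1 ≤ length xs
  ∈⇒1≤length (here _) = s≤s z≤n
  ∈⇒1≤length (there _) = s≤s z≤n

  distinct-∈⇒2≤length : ∀ {xs : List A} {x y} → x ∈ xs → y ∈ xs → x ≢ y → 2 ≤ length xs
  distinct-∈⇒2≤length (here refl) (here refl) x≢y = contradiction refl x≢y
  distinct-∈⇒2≤length (here refl) (there y∈) _ = s≤s (∈⇒1≤length y∈)
  distinct-∈⇒2≤length (there x∈) (here refl) _ = s≤s (∈⇒1≤length x∈)
  distinct-∈⇒2≤length (there x∈) (there y∈) x≢y = ℕP.m≤n⇒m≤1+n (distinct-∈⇒2≤length x∈ y∈ x≢y)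

  ∈-filterᵇ⁻ : ∀ (p : A → Bool) {xs x} → x ∈ filterᵇ p xs → x ∈ xs × p x ≡ true
  ∈-filterᵇ⁻ p x∈ with x∈xs , px ← ∈P.∈-filter⁻ (T? ∘ p) x∈ = x∈xs , Equivalence.to BoolP.T-≡ px

  ∈-filterᵇ⁺ : ∀ (p : A → Bool) {xs x} → x ∈ xs → p x ≡ true → x ∈ filterᵇ p xs
  ∈-filterᵇ⁺ p x∈ px = ∈P.∈-filter⁺ (T? ∘ p) x∈ (Equivalence.from BoolP.T-≡ px)

  ++⁺-∷ : ∀ {x : A} {ws xs ys zs} → ws ⊆ₛ (x ∷ xs) → ys ⊆ₛ (x ∷ zs) → (ws ++ ys) ⊆ₛ (x ∷ xs ++ zs)
  ++⁺-∷ {ws = ws} {xs} ws⊆ ys⊆ v∈ with ∈P.∈-++⁻ ws v∈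
  ... | inj₁ v∈ws with ws⊆ v∈ws
  ...   | here v≡x = here v≡x
  ...   | there v∈xs = there (∈P.∈-++⁺ˡ v∈xs)
  ++⁺-∷ {ws = ws} {xs} ws⊆ ys⊆ v∈ | inj₂ v∈ys with ys⊆ v∈ys
  ...   | here v≡x = here v≡x
  ...   | there v∈zs = there (∈P.∈-++⁺ʳ xs v∈zs)

  length-filterᵇ-split : ∀ (p : A → Bool) xs → length (filterᵇ p xs) + length (filterᵇ (not ∘ p) xs) ≡ length xs
  length-filterᵇ-split p [] = refl
  length-filterᵇ-split p (x ∷ xs) with p x
  ... | true = cong suc (length-filterᵇ-split p xs)
  ... | false = trans (ℕP.+-suc _ _) (cong suc (length-filterᵇ-split p xs))

-- Clusters of trees

module _ {m : ℕ} where

  leavesL-++ : ∀ (ts us : List (Tree m)) → leavesL (ts ++ us) ≡ leavesL ts ++ leavesL us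
  leavesL-++ [] us = refl
  leavesL-++ (t ∷ ts) us = trans (cong (leaves t ++_) (leavesL-++ ts us)) (sym (ListP.++-assoc (leaves t) _ _))

  ∈-leavesL⁻ : ∀ {ts : List (Tree m)} {i} → i ∈ leavesL ts → ∃[ c ] (c ∈ ts × i ∈ leaves c)
  ∈-leavesL⁻ {c ∷ ts} i∈ with ∈P.∈-++⁻ (leaves c) i∈
  ... | inj₁ i∈c = c , here refl , i∈c
  ... | inj₂ i∈ts with d , d∈ , i∈d ← ∈-leavesL⁻ {ts} i∈ts = d , there d∈ , i∈d

  ∈-leavesL⁺ : ∀ (ts : List (Tree m)) {c i} → c ∈ ts → i ∈ leaves c → i ∈ leavesL ts
  ∈-leavesL⁺ (c ∷ ts) (here refl) i∈c = ∈P.∈-++⁺ˡ i∈c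
  ∈-leavesL⁺ (c ∷ ts) (there c∈) i∈c = ∈P.∈-++⁺ʳ (leaves c) (∈-leavesL⁺ ts c∈ i∈c)

  open DecMembership (Fin._≟_ {m}) using (_∈?_)

  leafSet : Tree m → Subset m
  leafSet t = tabulate (λ i → ⌊ i ∈? leaves t ⌋)

  ∈leafSet⁻ : ∀ t {i} → i ∈S leafSet t → i ∈ leaves t
  ∈leafSet⁻ t {i} i∈ = witness⌊⌋ (i ∈? leaves t) (trans (sym (VecP.lookup∘tabulate _ i)) i∈)

  ∈leafSet⁺ : ∀ t {i} → i ∈ leaves t → i ∈S leafSet t
  ∈leafSet⁺ t {i} i∈ = trans (VecP.lookup∘tabulate _ i) (⌊⌋≡true (i ∈? leaves t) i∈)

  leafSet-cong : ∀ t u → leaves t ⊆ₛ leaves u → leaves u ⊆ₛ leaves t → leafSet t ≡ leafSet u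
  leafSet-cong t u t⊆u u⊆t =
    ⊆S-antisym (λ i i∈ → ∈leafSet⁺ u (t⊆u (∈leafSet⁻ t i∈))) (λ i i∈ → ∈leafSet⁺ t (u⊆t (∈leafSet⁻ u i∈)))

  leafSet-↭ : ∀ (ts us : List (Tree m)) → leavesL ts ↭ leavesL us → leafSet (node ts) ≡ leafSet (node us)
  leafSet-↭ ts us ts↭us = leafSet-cong (node ts) (node us) (↭P.∈-resp-↭ ts↭us) (↭P.∈-resp-↭ (↭-sym ts↭us))

  mutual
    clusters : Tree m → List (Subset m)
    clusters (leaf _) = []
    clusters (node ts) = leafSet (node ts) ∷ clustersL ts

    clustersL : List (Tree m) → List (Subset m)
    clustersL [] = []
    clustersL (t ∷ ts) = clusters t ++ clustersL ts

  properClusters : Tree m → List (Subset m)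
  properClusters (leaf _) = []
  properClusters (node ts) = clustersL ts

  clustersL-++ : ∀ (ts us : List (Tree m)) → clustersL (ts ++ us) ≡ clustersL ts ++ clustersL us
  clustersL-++ [] us = refl
  clustersL-++ (t ∷ ts) us = trans (cong (clusters t ++_) (clustersL-++ ts us)) (sym (ListP.++-assoc (clusters t) _ _))

  ∈-clustersL⁻ : ∀ {ts : List (Tree m)} {S} → S ∈ clustersL ts → ∃[ c ] (c ∈ ts × S ∈ clusters c)
  ∈-clustersL⁻ {c ∷ ts} S∈ with ∈P.∈-++⁻ (clusters c) S∈
  ... | inj₁ S∈c = c , here refl , S∈c
  ... | inj₂ S∈ts with d , d∈ , S∈d ← ∈-clustersL⁻ {ts} S∈ts = d , there d∈ , S∈d

  ∈-clustersL⁺ : ∀ {ts : List (Tree m)} {c S} → c ∈ ts → S ∈ clusters c → S ∈ clustersL ts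
  ∈-clustersL⁺ {c ∷ ts} (here refl) S∈c = ∈P.∈-++⁺ˡ S∈c
  ∈-clustersL⁺ {c ∷ ts} (there c∈) S∈c = ∈P.∈-++⁺ʳ (clusters c) (∈-clustersL⁺ c∈ S∈c)

  mutual
    Branching : Tree m → Set
    Branching (leaf _) = ⊤
    Branching (node ts) = 2 ≤ length ts × BranchingL ts

    BranchingL : List (Tree m) → Set
    BranchingL [] = ⊤
    BranchingL (t ∷ ts) = Branching t × BranchingL ts

  BranchingL-∈ : ∀ {ts : List (Tree m)} {c} → BranchingL ts → c ∈ ts → Branching c
  BranchingL-∈ (bc , _) (here refl) = bc
  BranchingL-∈ (_ , bts) (there c∈) = BranchingL-∈ bts c∈

  BranchingL-++ : ∀ (ts us : List (Tree m)) → BranchingL ts → BranchingL us → BranchingL (ts ++ us)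
  BranchingL-++ [] us _ bus = bus
  BranchingL-++ (t ∷ ts) us (bt , bts) bus = bt , BranchingL-++ ts us bts bus

  leaves-nonempty : ∀ (t : Tree m) → Branching t → ∃[ i ] (i ∈ leaves t)
  leaves-nonempty (leaf i) _ = i , here refl
  leaves-nonempty (node (c ∷ ts)) (_ , bc , _) with i , i∈ ← leaves-nonempty c bc = i , ∈P.∈-++⁺ˡ i∈

  Unique-child : ∀ {ts : List (Tree m)} {c} → Unique (leavesL ts) → c ∈ ts → Unique (leaves c)
  Unique-child {c ∷ ts} u (here refl) = Unique-++⁻ˡ (leaves c) u
  Unique-child {c ∷ ts} u (there c∈) = Unique-child (Unique-++⁻ʳ (leaves c) u) c∈

  shared-leaf⇒same-child : ∀ {ts : List (Tree m)} {c d i} → Unique (leavesL ts) → c ∈ ts → d ∈ ts →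
                           i ∈ leaves c → i ∈ leaves d → c ≡ d
  shared-leaf⇒same-child {t ∷ ts} u (here refl) (here refl) _ _ = refl
  shared-leaf⇒same-child {t ∷ ts} u (here refl) (there d∈) i∈c i∈d =
    contradiction (∈-leavesL⁺ ts d∈ i∈d) (Unique-++⇒disjoint (leaves t) u i∈c)
  shared-leaf⇒same-child {t ∷ ts} u (there c∈) (here refl) i∈c i∈d =
    contradiction (∈-leavesL⁺ ts c∈ i∈c) (Unique-++⇒disjoint (leaves t) u i∈d)
  shared-leaf⇒same-child {t ∷ ts} u (there c∈) (there d∈) =
    shared-leaf⇒same-child (Unique-++⁻ʳ (leaves t) u) c∈ d∈

  infix 4 _⊑_

  data _⊑_ : Tree m → Tree m → Set where
    self  : ∀ {t} → t ⊑ t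
    child : ∀ {t c ts} → c ∈ ts → t ⊑ c → t ⊑ node ts

  ⊑-leaves : ∀ {d t i} → d ⊑ t → i ∈ leaves d → i ∈ leaves t
  ⊑-leaves self i∈ = i∈
  ⊑-leaves (child {ts = ts} c∈ d⊑c) i∈ = ∈-leavesL⁺ ts c∈ (⊑-leaves d⊑c i∈)

  ⊑-Unique : ∀ {d t} → d ⊑ t → Unique (leaves t) → Unique (leaves d)
  ⊑-Unique self u = u
  ⊑-Unique (child c∈ d⊑c) u = ⊑-Unique d⊑c (Unique-child u c∈)

  ⊑-Branching : ∀ {d t} → d ⊑ t → Branching t → Branching d
  ⊑-Branching self b = b
  ⊑-Branching (child c∈ d⊑c) (_ , bts) = ⊑-Branching d⊑c (BranchingL-∈ bts c∈)

  mutual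
    clusters-⊑ : ∀ (t : Tree m) {S} → S ∈ clusters t → ∃[ ds ] (S ≡ leafSet (node ds) × node ds ⊑ t)
    clusters-⊑ (node ts) (here refl) = ts , refl , self
    clusters-⊑ (node ts) (there S∈) with ds , S≡ , c , c∈ , ds⊑c ← clustersL-⊑ ts S∈ = ds , S≡ , child c∈ ds⊑c

    clustersL-⊑ : ∀ (ts : List (Tree m)) {S} → S ∈ clustersL ts →
                  ∃[ ds ] (S ≡ leafSet (node ds) × ∃[ c ] (c ∈ ts × node ds ⊑ c))
    clustersL-⊑ (c ∷ ts) S∈ with ∈P.∈-++⁻ (clusters c) S∈
    ... | inj₁ S∈c with ds , S≡ , ds⊑c ← clusters-⊑ c S∈c = ds , S≡ , c , here refl , ds⊑c
    ... | inj₂ S∈ts with ds , S≡ , d , d∈ , ds⊑d ← clustersL-⊑ ts S∈ts = ds , S≡ , d , there d∈ , ds⊑d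

  two-distinct-leaves : ∀ (ts : List (Tree m)) → Unique (leavesL ts) → Branching (node ts) →
                        ∃[ a ] ∃[ b ] (a ∈ leavesL ts × b ∈ leavesL ts × a ≢ b)
  two-distinct-leaves (c₁ ∷ c₂ ∷ cs) u (s≤s (s≤s z≤n) , b₁ , b₂ , _)
    with a , a∈ ← leaves-nonempty c₁ b₁ | b , b∈ ← leaves-nonempty c₂ b₂ =
    a , b , ∈-leavesL⁺ (c₁ ∷ c₂ ∷ cs) (here refl) a∈ , ∈-leavesL⁺ (c₁ ∷ c₂ ∷ cs) (there (here refl)) b∈ ,
    λ { refl → Unique-++⇒disjoint (leaves c₁) u a∈ (∈-leavesL⁺ (c₂ ∷ cs) (here refl) b∈) }

  clusters⊆leaves : ∀ t {S} → S ∈ clusters t → ∀ i → i ∈S S → i ∈ leaves t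
  clusters⊆leaves t S∈ i i∈S with ds , refl , ds⊑t ← clusters-⊑ t S∈ = ⊑-leaves ds⊑t (∈leafSet⁻ (node ds) i∈S)

  clusters-2≤∣∣ : ∀ t {S} → Unique (leaves t) → Branching t → S ∈ clusters t → 2 ≤ ∣ S ∣
  clusters-2≤∣∣ t u b S∈ with ds , refl , ds⊑t ← clusters-⊑ t S∈
    with i , j , i∈ , j∈ , i≢j ← two-distinct-leaves ds (⊑-Unique ds⊑t u) (⊑-Branching ds⊑t b) =
    distinct-∈S⇒2≤∣∣ {S = leafSet (node ds)} (∈leafSet⁺ (node ds) i∈) (∈leafSet⁺ (node ds) j∈) i≢j

  clustersL-2≤∣∣ : ∀ ts {S} → Unique (leavesL ts) → BranchingL ts → S ∈ clustersL ts → 2 ≤ ∣ S ∣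
  clustersL-2≤∣∣ ts u b S∈ with c , c∈ , S∈c ← ∈-clustersL⁻ {ts} S∈ =
    clusters-2≤∣∣ c (Unique-child u c∈) (BranchingL-∈ b c∈) S∈c

  properClusters-2≤∣∣ : ∀ t {S} → Unique (leaves t) → Branching t → S ∈ properClusters t → 2 ≤ ∣ S ∣
  properClusters-2≤∣∣ (node ts) u (_ , bts) = clustersL-2≤∣∣ ts u bts

  clustersL-proper : ∀ ts {S} → Unique (leavesL ts) → Branching (node ts) → S ∈ clustersL ts →
                     ∃[ i ] (i ∈ leavesL ts × ¬ i ∈S S)
  clustersL-proper ts@(c₁ ∷ c₂ ∷ cs) {S} u (s≤s (s≤s z≤n) , b₁ , b₂ , _) S∈
    with leaves-nonempty c₁ b₁ | leaves-nonempty c₂ b₂ | ∈-clustersL⁻ {ts} S∈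
  ... | i , i∈ | j , j∈ | c , c∈ , S∈c with i ∈S? S | j ∈S? S
  ... | no i∉S | _ = i , ∈-leavesL⁺ ts (here refl) i∈ , i∉S
  ... | yes _ | no j∉S = j , ∈-leavesL⁺ ts (there (here refl)) j∈ , j∉S
  ... | yes i∈S | yes j∈S
    with refl ← shared-leaf⇒same-child u c∈ (here refl) (clusters⊆leaves c S∈c i i∈S) i∈
       | refl ← shared-leaf⇒same-child u c∈ (there (here refl)) (clusters⊆leaves c S∈c j j∈S) j∈ =
    contradiction (∈-leavesL⁺ (c₂ ∷ cs) (here refl) j∈) (Unique-++⇒disjoint (leaves c) u (clusters⊆leaves c S∈c j j∈S))

  properClusters-proper : ∀ t {S} → Unique (leaves t) → Branching t → S ∈ properClusters t → ∃[ i ] (¬ i ∈S S)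
  properClusters-proper (node ts) u b S∈ with i , _ , i∉S ← clustersL-proper ts u b S∈ = i , i∉S

Laminar : ∀ {m} → List (Subset m) → Set
Laminar Ss = ∀ {S T} → S ∈ Ss → T ∈ Ss → Intersect S T → S ⊆S T ⊎ T ⊆S S

module _ {m : ℕ} where

  mutual
    clusters-laminar : ∀ (t : Tree m) → Unique (leaves t) → Laminar (clusters t)
    clusters-laminar (node ts) u (here refl) T∈ _ =
      inj₂ (λ i i∈T → ∈leafSet⁺ (node ts) (clusters⊆leaves (node ts) T∈ i i∈T))
    clusters-laminar (node ts) u (there S∈) (here refl) _ =
      inj₁ (λ i i∈S → ∈leafSet⁺ (node ts) (clusters⊆leaves (node ts) (there S∈) i i∈S))
    clusters-laminar (node ts) u (there S∈) (there T∈) = clustersL-laminar ts u S∈ T∈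

    clustersL-laminar : ∀ (ts : List (Tree m)) → Unique (leavesL ts) → Laminar (clustersL ts)
    clustersL-laminar ts u S∈ T∈ S∩T@(i , i∈S , i∈T)
      with ∈-clustersL⁻ {ts = ts} S∈ | ∈-clustersL⁻ {ts = ts} T∈
    ... | c , c∈ , S∈c | d , d∈ , T∈d
      with refl ← shared-leaf⇒same-child u c∈ d∈ (clusters⊆leaves c S∈c i i∈S) (clusters⊆leaves d T∈d i i∈T) =
      All.lookup (children-laminar ts u) c∈ S∈c T∈d S∩T

    children-laminar : ∀ (ts : List (Tree m)) → Unique (leavesL ts) → All (Laminar ∘ clusters) ts
    children-laminar [] _ = []
    children-laminar (c ∷ ts) u = clusters-laminar c (Unique-++⁻ˡ (leaves c) u) ∷ children-laminar ts (Unique-++⁻ʳ (leaves c) u)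

  properClusters-laminar : ∀ (t : Tree m) → Unique (leaves t) → Laminar (properClusters t)
  properClusters-laminar (leaf _) _ ()
  properClusters-laminar (node ts) u = clustersL-laminar ts u

-- Clusters determine a tree up to isomorphism

module _ {m : ℕ} where

  mutual
    ≅-refl : ∀ (t : Tree m) → t ≅ t
    ≅-refl (leaf i) = leaf i
    ≅-refl (node ts) = node (PermH.refl (Pointwise-≅-refl ts))

    Pointwise-≅-refl : ∀ (ts : List (Tree m)) → Pointwise _≅_ ts ts
    Pointwise-≅-refl [] = []
    Pointwise-≅-refl (t ∷ ts) = ≅-refl t ∷ Pointwise-≅-refl ts

  mutual
    ≅-sym : ∀ {t u : Tree m} → t ≅ u → u ≅ t
    ≅-sym (leaf i) = leaf i
    ≅-sym (node p) = node (Permutation-≅-sym p)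

    Permutation-≅-sym : ∀ {ts us : List (Tree m)} → PermH.Permutation _≅_ ts us → PermH.Permutation _≅_ us ts
    Permutation-≅-sym (PermH.refl ps) = PermH.refl (Pointwise-≅-sym ps)
    Permutation-≅-sym (PermH.prep e p) = PermH.prep (≅-sym e) (Permutation-≅-sym p)
    Permutation-≅-sym (PermH.swap e₁ e₂ p) = PermH.swap (≅-sym e₂) (≅-sym e₁) (Permutation-≅-sym p)
    Permutation-≅-sym (PermH.trans p q) = PermH.trans (Permutation-≅-sym q) (Permutation-≅-sym p)

    Pointwise-≅-sym : ∀ {ts us : List (Tree m)} → Pointwise _≅_ ts us → Pointwise _≅_ us ts
    Pointwise-≅-sym [] = []
    Pointwise-≅-sym (e ∷ ps) = ≅-sym e ∷ Pointwise-≅-sym ps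

  mutual
    ≅-leaves : ∀ {t u : Tree m} → t ≅ u → leaves t ↭ leaves u
    ≅-leaves (leaf i) = ↭-refl
    ≅-leaves (node p) = Permutation-≅-leavesL p

    Permutation-≅-leavesL : ∀ {ts us : List (Tree m)} → PermH.Permutation _≅_ ts us → leavesL ts ↭ leavesL us
    Permutation-≅-leavesL (PermH.refl ps) = Pointwise-≅-leavesL ps
    Permutation-≅-leavesL (PermH.prep e p) = ↭P.++⁺ (≅-leaves e) (Permutation-≅-leavesL p)
    Permutation-≅-leavesL (PermH.swap {x′ = x′} {y′} e₁ e₂ p) =
      ↭-trans (↭P.++⁺ (≅-leaves e₁) (↭P.++⁺ (≅-leaves e₂) (Permutation-≅-leavesL p)))
              (↭P.shifts (leaves x′) (leaves y′))
    Permutation-≅-leavesL (PermH.trans p q) = ↭-trans (Permutation-≅-leavesL p) (Permutation-≅-leavesL q)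

    Pointwise-≅-leavesL : ∀ {ts us : List (Tree m)} → Pointwise _≅_ ts us → leavesL ts ↭ leavesL us
    Pointwise-≅-leavesL [] = ↭-refl
    Pointwise-≅-leavesL (e ∷ ps) = ↭P.++⁺ (≅-leaves e) (Pointwise-≅-leavesL ps)

  ≅-leafSet : ∀ {t u : Tree m} → t ≅ u → leafSet t ≡ leafSet u
  ≅-leafSet {t} {u} t≅u =
    leafSet-cong t u (↭P.∈-resp-↭ (≅-leaves t≅u)) (↭P.∈-resp-↭ (↭-sym (≅-leaves t≅u)))

  mutual
    ≅-clusters : ∀ {t u : Tree m} → t ≅ u → clusters t ⊆ₛ clusters u
    ≅-clusters (node p) (here refl) = here (≅-leafSet (node p))
    ≅-clusters (node p) (there S∈) = there (Permutation-≅-clustersL p S∈)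

    Permutation-≅-clustersL : ∀ {ts us : List (Tree m)} → PermH.Permutation _≅_ ts us → clustersL ts ⊆ₛ clustersL us
    Permutation-≅-clustersL (PermH.refl ps) = Pointwise-≅-clustersL ps
    Permutation-≅-clustersL (PermH.prep e p) = ⊆P.++⁺ (≅-clusters e) (Permutation-≅-clustersL p)
    Permutation-≅-clustersL (PermH.swap {x = x} {y} {x′} {y′} e₁ e₂ p) S∈ with ∈P.∈-++⁻ (clusters x) S∈
    ... | inj₁ S∈x = ∈P.∈-++⁺ʳ (clusters y′) (∈P.∈-++⁺ˡ (≅-clusters e₁ S∈x))
    ... | inj₂ S∈ with ∈P.∈-++⁻ (clusters y) S∈
    ...   | inj₁ S∈y = ∈P.∈-++⁺ˡ (≅-clusters e₂ S∈y)
    ...   | inj₂ S∈xs = ∈P.∈-++⁺ʳ (clusters y′) (∈P.∈-++⁺ʳ (clusters x′) (Permutation-≅-clustersL p S∈xs))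
    Permutation-≅-clustersL (PermH.trans p q) = Permutation-≅-clustersL q ∘ Permutation-≅-clustersL p

    Pointwise-≅-clustersL : ∀ {ts us : List (Tree m)} → Pointwise _≅_ ts us → clustersL ts ⊆ₛ clustersL us
    Pointwise-≅-clustersL [] = id
    Pointwise-≅-clustersL (e ∷ ps) = ⊆P.++⁺ (≅-clusters e) (Pointwise-≅-clustersL ps)

  ≅-properClusters : ∀ {t u : Tree m} → t ≅ u → properClusters t ⊆ₛ properClusters u
  ≅-properClusters (node p) = Permutation-≅-clustersL p

module KeyedPermutation {A K : Set} (_≈_ : A → A → Set) (≈-refl : ∀ x → x ≈ x) (key : A → K) where

  DistinctKeys : A → A → Set
  DistinctKeys a b = key a ≢ key b

  private
    Pointwise-refl : ∀ xs → Pointwise _≈_ xs xs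
    Pointwise-refl [] = []
    Pointwise-refl (x ∷ xs) = ≈-refl x ∷ Pointwise-refl xs

    shift : ∀ (y : A) (as bs : List A) → PermH.Permutation _≈_ (y ∷ as ++ bs) (as ++ y ∷ bs)
    shift y [] bs = PermH.refl (Pointwise-refl (y ∷ bs))
    shift y (a ∷ as) bs =
      PermH.trans (PermH.swap (≈-refl y) (≈-refl a) (PermH.refl (Pointwise-refl (as ++ bs))))
                  (PermH.prep (≈-refl a) (shift y as bs))

    All-remove : ∀ {P : A → Set} (as : List A) {y} bs → All P (as ++ y ∷ bs) → All P (as ++ bs)
    All-remove [] bs (_ ∷ pbs) = pbs
    All-remove (a ∷ as) bs (pa ∷ ps) = pa ∷ All-remove as bs ps

    AllPairs-remove : ∀ (as : List A) {y} bs → AllPairs DistinctKeys (as ++ y ∷ bs) → AllPairs DistinctKeys (as ++ bs)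
    AllPairs-remove [] bs (_ ∷ ds) = ds
    AllPairs-remove (a ∷ as) bs (da ∷ ds) = All-remove as bs da ∷ AllPairs-remove as bs ds

    key-≢-removed : ∀ (as : List A) {y} bs {z} → AllPairs DistinctKeys (as ++ y ∷ bs) → z ∈ as ++ bs → key z ≢ key y
    key-≢-removed [] bs (dy ∷ _) z∈ e = All.lookup dy z∈ (sym e)
    key-≢-removed (a ∷ as) bs (da ∷ _) (here refl) = All.lookup da (∈P.∈-++⁺ʳ as (here refl))
    key-≢-removed (a ∷ as) bs (_ ∷ ds) (there z∈) = key-≢-removed as bs ds z∈

    ∈-remove : ∀ (as : List A) {y} bs {z} → z ∈ as ++ y ∷ bs → key z ≢ key y → z ∈ as ++ bs
    ∈-remove as bs z∈ z≉y with ∈P.∈-++⁻ as z∈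
    ... | inj₁ z∈as = ∈P.∈-++⁺ˡ z∈as
    ... | inj₂ (here refl) = contradiction refl z≉y
    ... | inj₂ (there z∈bs) = ∈P.∈-++⁺ʳ as z∈bs

    ∈-insert : ∀ (as : List A) {y} bs {z} → z ∈ as ++ bs → z ∈ as ++ y ∷ bs
    ∈-insert as bs z∈ with ∈P.∈-++⁻ as z∈
    ... | inj₁ z∈as = ∈P.∈-++⁺ˡ z∈as
    ... | inj₂ z∈bs = ∈P.∈-++⁺ʳ as (there z∈bs)

  permutation-by-key : ∀ (xs ys : List A) → AllPairs DistinctKeys xs → AllPairs DistinctKeys ys →
    All (λ x → ∃[ y ] (y ∈ ys × key x ≡ key y × x ≈ y)) xs →
    All (λ y → ∃[ x ] (x ∈ xs × key x ≡ key y)) ys → PermH.Permutation _≈_ xs ys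
  permutation-by-key [] [] _ _ _ _ = PermH.refl []
  permutation-by-key [] (y ∷ ys) _ _ _ ((x , () , _) ∷ _)
  permutation-by-key (x ∷ xs) ys (dx ∷ dxs) dys ((y , y∈ , kx≡ky , x≈y) ∷ matchˡ) matchʳ
    with as , bs , refl ← ∈P.∈-∃++ y∈ =
    PermH.trans (PermH.prep x≈y (permutation-by-key xs (as ++ bs) dxs (AllPairs-remove as bs dys) matchˡ′ matchʳ′))
                (shift y as bs)
    where
    matchˡ′ : All (λ x′ → ∃[ y′ ] (y′ ∈ as ++ bs × key x′ ≡ key y′ × x′ ≈ y′)) xs
    matchˡ′ = All.tabulate λ {x′} x′∈ → let (y′ , y′∈ , k , r) = All.lookup matchˡ x′∈ in
      y′ , ∈-remove as bs y′∈ (λ e → All.lookup dx x′∈ (trans kx≡ky (trans (sym e) (sym k)))) , k , r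
    unmatched : ∀ {y′} → y′ ∈ as ++ bs → ∃[ x′ ] (x′ ∈ x ∷ xs × key x′ ≡ key y′) → ∃[ x′ ] (x′ ∈ xs × key x′ ≡ key y′)
    unmatched y′∈ (_ , here refl , k) = contradiction (trans (sym k) kx≡ky) (key-≢-removed as bs dys y′∈)
    unmatched y′∈ (x′ , there x′∈ , k) = x′ , x′∈ , k
    matchʳ′ : All (λ y′ → ∃[ x′ ] (x′ ∈ xs × key x′ ≡ key y′)) (as ++ bs)
    matchʳ′ = All.tabulate λ y′∈ → unmatched y′∈ (All.lookup matchʳ (∈-insert as bs y′∈))

module _ {m : ℕ} where

  open KeyedPermutation {Tree m} _≅_ ≅-refl leafSet using (permutation-by-key)

  children-leafSets-distinct : ∀ (ts : List (Tree m)) → Unique (leavesL ts) → BranchingL ts →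
                               AllPairs (λ c d → leafSet c ≢ leafSet d) ts
  children-leafSets-distinct [] _ _ = []
  children-leafSets-distinct (c ∷ ts) u (bc , bts) =
    All.tabulate distinct ∷ children-leafSets-distinct ts (Unique-++⁻ʳ (leaves c) u) bts
    where
    distinct : ∀ {d} → d ∈ ts → leafSet c ≢ leafSet d
    distinct {d} d∈ e with i , i∈c ← leaves-nonempty c bc =
      Unique-++⇒disjoint (leaves c) u i∈c (∈-leavesL⁺ ts d∈ (∈leafSet⁻ d (subst (i ∈S_) e (∈leafSet⁺ c i∈c))))

  child-leaves-⊆ : ∀ (ts us : List (Tree m)) → Unique (leavesL us) → clustersL ts ⊆ₛ clustersL us →
                   ∀ {c d i} → c ∈ ts → d ∈ us → i ∈ leaves c → i ∈ leaves d → leaves c ⊆ₛ leaves d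
  child-leaves-⊆ ts us u _ {leaf _} _ _ (here refl) i∈d (here refl) = i∈d
  child-leaves-⊆ ts us u ts⊆us {node cs} {d} {i} c∈ d∈ i∈c i∈d {j} j∈c
    with e , e∈ , S∈e ← ∈-clustersL⁻ {ts = us} (ts⊆us (∈-clustersL⁺ c∈ (here refl)))
    with refl ← shared-leaf⇒same-child u e∈ d∈ (clusters⊆leaves e S∈e i (∈leafSet⁺ (node cs) i∈c)) i∈d =
    clusters⊆leaves e S∈e j (∈leafSet⁺ (node cs) j∈c)

  matching-child : ∀ (ts us : List (Tree m)) → Unique (leavesL ts) → Unique (leavesL us) → BranchingL ts →
    leavesL ts ⊆ₛ leavesL us → clustersL ts ⊆ₛ clustersL us → clustersL us ⊆ₛ clustersL ts → ∀ {c} → c ∈ ts →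
    ∃[ d ] (d ∈ us × leaves c ⊆ₛ leaves d × leaves d ⊆ₛ leaves c)
  matching-child ts us uts uus bts lts⊆lus ts⊆us us⊆ts {c} c∈
    with i , i∈c ← leaves-nonempty c (BranchingL-∈ bts c∈)
    with d , d∈ , i∈d ← ∈-leavesL⁻ {ts = us} (lts⊆lus (∈-leavesL⁺ ts c∈ i∈c)) =
    d , d∈ , child-leaves-⊆ ts us uus ts⊆us c∈ d∈ i∈c i∈d , child-leaves-⊆ us ts uts us⊆ts d∈ c∈ i∈d i∈c

  ∈-properClusters-child⁻ : ∀ (ts : List (Tree m)) {c S} → Unique (leavesL ts) → BranchingL ts → c ∈ ts →
    S ∈ properClusters c → S ∈ clustersL ts × (∀ i → i ∈S S → i ∈ leaves c) × (∃[ i ] (i ∈ leaves c × ¬ i ∈S S))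
  ∈-properClusters-child⁻ ts {node cs} u b c∈ S∈ =
    ∈-clustersL⁺ c∈ (there S∈) , clusters⊆leaves (node cs) (there S∈) ,
    clustersL-proper cs (Unique-child u c∈) (BranchingL-∈ b c∈) S∈

  ∈-properClusters-child⁺ : ∀ (ts : List (Tree m)) {c S} → Unique (leavesL ts) → BranchingL ts → c ∈ ts →
    S ∈ clustersL ts → (∀ i → i ∈S S → i ∈ leaves c) → (∃[ i ] (i ∈ leaves c × ¬ i ∈S S)) → S ∈ properClusters c
  ∈-properClusters-child⁺ ts {c} {S} u b c∈ S∈ S⊆c (i , i∈c , i∉S) with ∈-clustersL⁻ {ts = ts} S∈
  ... | d , d∈ , S∈d with 2≤∣∣⇒∃∈S {S = S} (clusters-2≤∣∣ d (Unique-child u d∈) (BranchingL-∈ b d∈) S∈d)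
  ... | j , j∈S with shared-leaf⇒same-child u d∈ c∈ (clusters⊆leaves d S∈d j j∈S) (S⊆c j j∈S)
  ∈-properClusters-child⁺ ts {node cs} u b c∈ S∈ S⊆c (i , i∈c , i∉S) | _ , _ , here refl | _ | refl =
    contradiction (∈leafSet⁺ (node cs) i∈c) i∉S
  ∈-properClusters-child⁺ ts {node cs} u b c∈ S∈ S⊆c (i , i∈c , i∉S) | _ , _ , there S∈′ | _ | refl = S∈′

  properClusters-child-⊆ : ∀ (ts us : List (Tree m)) → Unique (leavesL ts) → BranchingL ts →
    Unique (leavesL us) → BranchingL us → clustersL ts ⊆ₛ clustersL us → ∀ {c d} → c ∈ ts → d ∈ us →
    leaves c ⊆ₛ leaves d → properClusters c ⊆ₛ properClusters d
  properClusters-child-⊆ ts us uts bts uus bus ts⊆us c∈ d∈ c⊆d S∈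
    with S∈ts , S⊆c , (i , i∈c , i∉S) ← ∈-properClusters-child⁻ ts uts bts c∈ S∈ =
    ∈-properClusters-child⁺ us uus bus d∈ (ts⊆us S∈ts) (λ j j∈S → c⊆d (S⊆c j j∈S)) (i , c⊆d i∈c , i∉S)

  DeterminedByClusters : Tree m → Set
  DeterminedByClusters t = ∀ u → Unique (leaves t) → Branching t → Unique (leaves u) → Branching u →
    leaves t ⊆ₛ leaves u → leaves u ⊆ₛ leaves t →
    properClusters t ⊆ₛ properClusters u → properClusters u ⊆ₛ properClusters t → t ≅ u

  mutual
    ≅-from-clusters : ∀ (t : Tree m) → DeterminedByClusters t
    ≅-from-clusters (leaf i) (leaf j) _ _ _ _ i⊆j _ _ _ with here refl ← i⊆j (here refl) = leaf i
    ≅-from-clusters (leaf i) (node us) _ _ uus bus _ us⊆i _ _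
      with a , b , a∈ , b∈ , a≢b ← two-distinct-leaves us uus bus
      with here refl ← us⊆i a∈ | here refl ← us⊆i b∈ = contradiction refl a≢b
    ≅-from-clusters (node ts) (leaf j) uts bts _ _ ts⊆j _ _ _
      with a , b , a∈ , b∈ , a≢b ← two-distinct-leaves ts uts bts
      with here refl ← ts⊆j a∈ | here refl ← ts⊆j b∈ = contradiction refl a≢b
    ≅-from-clusters (node ts) (node us) uts (_ , bts) uus (_ , bus) ts⊆us us⊆ts cts⊆cus cus⊆cts =
      node (permutation-by-key ts us (children-leafSets-distinct ts uts bts) (children-leafSets-distinct us uus bus)
                              matchˡ matchʳ)
      where
      matchˡ : All (λ c → ∃[ d ] (d ∈ us × leafSet c ≡ leafSet d × c ≅ d)) ts
      matchˡ = All.tabulate λ {c} c∈ →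
        let (d , d∈ , c⊆d , d⊆c) = matching-child ts us uts uus bts ts⊆us cts⊆cus cus⊆cts c∈ in
        d , d∈ , leafSet-cong c d c⊆d d⊆c ,
        All.lookup (≅-from-clustersL ts) c∈ d (Unique-child uts c∈) (BranchingL-∈ bts c∈)
          (Unique-child uus d∈) (BranchingL-∈ bus d∈) c⊆d d⊆c
          (properClusters-child-⊆ ts us uts bts uus bus cts⊆cus c∈ d∈ c⊆d)
          (properClusters-child-⊆ us ts uus bus uts bts cus⊆cts d∈ c∈ d⊆c)
      matchʳ : All (λ d → ∃[ c ] (c ∈ ts × leafSet c ≡ leafSet d)) us
      matchʳ = All.tabulate λ {d} d∈ →
        let (c , c∈ , d⊆c , c⊆d) = matching-child us ts uus uts bus us⊆ts cus⊆cts cts⊆cus d∈ in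
        c , c∈ , leafSet-cong c d c⊆d d⊆c

    ≅-from-clustersL : ∀ (ts : List (Tree m)) → All DeterminedByClusters ts
    ≅-from-clustersL [] = []
    ≅-from-clustersL (t ∷ ts) = ≅-from-clusters t ∷ ≅-from-clustersL ts

-- Contractions

module _ {m : ℕ} where

  leafSet-≡ : ∀ (ts us : List (Tree m)) → leavesL ts ≡ leavesL us → leafSet (node ts) ≡ leafSet (node us)
  leafSet-≡ ts us e = leafSet-↭ ts us (↭.↭-reflexive e)

  Star-⇝-inside : ∀ (as bs : List (Tree m)) {t u} → Star _⇝_ t u → Star _⇝_ (node (as ++ t ∷ bs)) (node (as ++ u ∷ bs))
  Star-⇝-inside as bs ε = ε
  Star-⇝-inside as bs (t⇝ ◅ ⇝⋆) = there as bs t⇝ ◅ Star-⇝-inside as bs ⇝⋆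

  ⇝-shrinks : ∀ {t u : Tree m} → t ⇝ u →
              leaves u ≡ leaves t × properClusters u ⊆ₛ properClusters t × clusters u ⊆ₛ clusters t
  ⇝-shrinks (here as cs bs) = same-leaves , properClusters-⊆ , clusters-⊆
    where
    same-leaves : leavesL (as ++ cs ++ bs) ≡ leavesL (as ++ node cs ∷ bs)
    same-leaves = begin
      leavesL (as ++ cs ++ bs)                ≡⟨ leavesL-++ as (cs ++ bs) ⟩
      leavesL as ++ leavesL (cs ++ bs)        ≡⟨ cong (leavesL as ++_) (leavesL-++ cs bs) ⟩
      leavesL as ++ leavesL (node cs ∷ bs)    ≡⟨ leavesL-++ as (node cs ∷ bs) ⟨
      leavesL (as ++ node cs ∷ bs)            ∎
      where open ≡.≡-Reasoning
    properClusters-⊆ : clustersL (as ++ cs ++ bs) ⊆ₛ clustersL (as ++ node cs ∷ bs)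
    properClusters-⊆ S∈ rewrite clustersL-++ as (cs ++ bs) | clustersL-++ cs bs | clustersL-++ as (node cs ∷ bs) =
      ⊆P.++⁺ {ws = clustersL as} id (⊆P.++⁺ {ws = clustersL cs} there id) S∈
    clusters-⊆ : clusters (node (as ++ cs ++ bs)) ⊆ₛ clusters (node (as ++ node cs ∷ bs))
    clusters-⊆ (here refl) = here (leafSet-≡ (as ++ cs ++ bs) (as ++ node cs ∷ bs) same-leaves)
    clusters-⊆ (there S∈) = there (properClusters-⊆ S∈)
  ⇝-shrinks (there as bs {t} {u} t⇝u) with same-leavesᵗ , _ , clustersᵗ-⊆ ← ⇝-shrinks t⇝u =
    same-leaves , properClusters-⊆ , clusters-⊆
    where
    same-leaves : leavesL (as ++ u ∷ bs) ≡ leavesL (as ++ t ∷ bs)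
    same-leaves = begin
      leavesL (as ++ u ∷ bs)                  ≡⟨ leavesL-++ as (u ∷ bs) ⟩
      leavesL as ++ leaves u ++ leavesL bs    ≡⟨ cong (λ l → leavesL as ++ l ++ leavesL bs) same-leavesᵗ ⟩
      leavesL as ++ leaves t ++ leavesL bs    ≡⟨ leavesL-++ as (t ∷ bs) ⟨
      leavesL (as ++ t ∷ bs)                  ∎
      where open ≡.≡-Reasoning
    properClusters-⊆ : clustersL (as ++ u ∷ bs) ⊆ₛ clustersL (as ++ t ∷ bs)
    properClusters-⊆ S∈ rewrite clustersL-++ as (u ∷ bs) | clustersL-++ as (t ∷ bs) =
      ⊆P.++⁺ {ws = clustersL as} id (⊆P.++⁺ {ws = clusters u} clustersᵗ-⊆ id) S∈
    clusters-⊆ : clusters (node (as ++ u ∷ bs)) ⊆ₛ clusters (node (as ++ t ∷ bs))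
    clusters-⊆ (here refl) = here (leafSet-≡ (as ++ u ∷ bs) (as ++ t ∷ bs) same-leaves)
    clusters-⊆ (there S∈) = there (properClusters-⊆ S∈)

  contractions-shrink : ∀ {t u : Tree m} → Star _⇝_ t u → leaves u ≡ leaves t × properClusters u ⊆ₛ properClusters t
  contractions-shrink ε = refl , id
  contractions-shrink (t⇝ ◅ ⇝⋆) with l₁ , c₁ , _ ← ⇝-shrinks t⇝ | l₂ , c₂ ← contractions-shrink ⇝⋆ =
    trans l₂ l₁ , c₁ ∘ c₂

module Contract {m : ℕ} (keep : Subset m → Bool) where

  keepOrSplice : Bool → List (Tree m) → List (Tree m) → List (Tree m)
  keepOrSplice true cs ts = node cs ∷ ts
  keepOrSplice false cs ts = cs ++ ts

  mutual
    contract : Tree m → Tree m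
    contract (leaf i) = leaf i
    contract (node ts) = node (contractL ts)

    contractL : List (Tree m) → List (Tree m)
    contractL [] = []
    contractL (leaf i ∷ ts) = leaf i ∷ contractL ts
    contractL (node cs ∷ ts) = keepOrSplice (keep (leafSet (node cs))) (contractL cs) (contractL ts)

  contractL-leaves : ∀ ts → leavesL (contractL ts) ≡ leavesL ts
  contractL-leaves [] = refl
  contractL-leaves (leaf i ∷ ts) = cong (i ∷_) (contractL-leaves ts)
  contractL-leaves (node cs ∷ ts) with keep (leafSet (node cs))
  ... | true = cong₂ _++_ (contractL-leaves cs) (contractL-leaves ts)
  ... | false = trans (leavesL-++ (contractL cs) (contractL ts)) (cong₂ _++_ (contractL-leaves cs) (contractL-leaves ts))

  contract-leaves : ∀ t → leaves (contract t) ≡ leaves t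
  contract-leaves (leaf i) = refl
  contract-leaves (node ts) = contractL-leaves ts

  leafSet-contractL : ∀ cs → leafSet (node (contractL cs)) ≡ leafSet (node cs)
  leafSet-contractL cs = leafSet-≡ (contractL cs) cs (contractL-leaves cs)

  private
    NodeStar : List (Tree m) → List (Tree m) → Set
    NodeStar ts us = Star _⇝_ (node ts) (node us)

    past : ∀ as x {ys zs} → NodeStar ((as ++ x ∷ []) ++ ys) ((as ++ x ∷ []) ++ zs) → NodeStar (as ++ x ∷ ys) (as ++ x ∷ zs)
    past as x {ys} {zs} = subst₂ NodeStar (ListP.++-assoc as (x ∷ []) ys) (ListP.++-assoc as (x ∷ []) zs)

  mutual
    contractL-reachable : ∀ ts (as bs : List (Tree m)) → NodeStar (as ++ ts ++ bs) (as ++ contractL ts ++ bs)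
    contractL-reachable [] as bs = ε
    contractL-reachable (leaf i ∷ ts) as bs = past as (leaf i) (contractL-reachable ts (as ++ leaf i ∷ []) bs)
    contractL-reachable (node cs ∷ ts) as bs with keep (leafSet (node cs))
    ... | true = Star-⇝-inside as (ts ++ bs) (contract-node-reachable cs) ◅◅
                 past as (node (contractL cs)) (contractL-reachable ts (as ++ node (contractL cs) ∷ []) bs)
    ... | false = Star-⇝-inside as (ts ++ bs) (contract-node-reachable cs) ◅◅
                  (here as (contractL cs) (ts ++ bs) ◅
                   subst₂ NodeStar (ListP.++-assoc as (contractL cs) (ts ++ bs))
                     (trans (ListP.++-assoc as (contractL cs) (contractL ts ++ bs))
                            (cong (as ++_) (sym (ListP.++-assoc (contractL cs) (contractL ts) bs))))
                     (contractL-reachable ts (as ++ contractL cs) bs))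

    contract-node-reachable : ∀ cs → NodeStar cs (contractL cs)
    contract-node-reachable cs =
      subst₂ NodeStar (ListP.++-identityʳ cs) (ListP.++-identityʳ (contractL cs)) (contractL-reachable cs [] [])

  contract-reachable : ∀ t → Star _⇝_ t (contract t)
  contract-reachable (leaf i) = ε
  contract-reachable (node ts) = contract-node-reachable ts

  ∈-clustersL-contractL⁻ : ∀ ts {S} → S ∈ clustersL (contractL ts) → S ∈ clustersL ts × keep S ≡ true
  ∈-clustersL-contractL⁻ (leaf i ∷ ts) S∈ = ∈-clustersL-contractL⁻ ts S∈
  ∈-clustersL-contractL⁻ (node cs ∷ ts) {S} S∈ with keep (leafSet (node cs)) in kept
  ... | true with ∈P.∈-++⁻ (clusters (node (contractL cs))) S∈
  ...   | inj₁ (here S≡) = here (trans S≡ (leafSet-contractL cs)) ,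
                           subst (λ X → keep X ≡ true) (sym (trans S≡ (leafSet-contractL cs))) kept
  ...   | inj₁ (there S∈cs) with S∈ , kS ← ∈-clustersL-contractL⁻ cs S∈cs = ∈P.∈-++⁺ˡ (there S∈) , kS
  ...   | inj₂ S∈ts with S∈ , kS ← ∈-clustersL-contractL⁻ ts S∈ts = ∈P.∈-++⁺ʳ (clusters (node cs)) S∈ , kS
  ∈-clustersL-contractL⁻ (node cs ∷ ts) {S} S∈ | false
    rewrite clustersL-++ (contractL cs) (contractL ts) with ∈P.∈-++⁻ (clustersL (contractL cs)) S∈
  ... | inj₁ S∈cs with S∈ , kS ← ∈-clustersL-contractL⁻ cs S∈cs = ∈P.∈-++⁺ˡ (there S∈) , kS
  ... | inj₂ S∈ts with S∈ , kS ← ∈-clustersL-contractL⁻ ts S∈ts = ∈P.∈-++⁺ʳ (clusters (node cs)) S∈ , kS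

  ∈-clustersL-contractL⁺ : ∀ ts {S} → S ∈ clustersL ts → keep S ≡ true → S ∈ clustersL (contractL ts)
  ∈-clustersL-contractL⁺ (leaf i ∷ ts) S∈ kS = ∈-clustersL-contractL⁺ ts S∈ kS
  ∈-clustersL-contractL⁺ (node cs ∷ ts) {S} S∈ kS with keep (leafSet (node cs)) in kept | ∈P.∈-++⁻ (clusters (node cs)) S∈
  ... | true | inj₁ (here refl) = here (sym (leafSet-contractL cs))
  ... | false | inj₁ (here refl) = contradiction (trans (sym kS) kept) true≢false
  ... | true | inj₁ (there S∈cs) = there (∈P.∈-++⁺ˡ (∈-clustersL-contractL⁺ cs S∈cs kS))
  ... | false | inj₁ (there S∈cs) rewrite clustersL-++ (contractL cs) (contractL ts) =
    ∈P.∈-++⁺ˡ (∈-clustersL-contractL⁺ cs S∈cs kS)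
  ... | true | inj₂ S∈ts = ∈P.∈-++⁺ʳ (clusters (node (contractL cs))) (∈-clustersL-contractL⁺ ts S∈ts kS)
  ... | false | inj₂ S∈ts rewrite clustersL-++ (contractL cs) (contractL ts) =
    ∈P.∈-++⁺ʳ (clustersL (contractL cs)) (∈-clustersL-contractL⁺ ts S∈ts kS)

  contractL-Branching : ∀ ts → BranchingL ts → length ts ≤ length (contractL ts) × BranchingL (contractL ts)
  contractL-Branching [] _ = z≤n , tt
  contractL-Branching (leaf i ∷ ts) (_ , bts) with l , b ← contractL-Branching ts bts = s≤s l , tt , b
  contractL-Branching (node cs ∷ ts) ((2≤cs , bcs) , bts)
    with contractL-Branching cs bcs | contractL-Branching ts bts | keep (leafSet (node cs))
  ... | lcs , bcs′ | lts , bts′ | true = s≤s lts , (ℕP.≤-trans 2≤cs lcs , bcs′) , bts′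
  ... | lcs , bcs′ | lts , bts′ | false = longer , BranchingL-++ (contractL cs) (contractL ts) bcs′ bts′
    where
    longer : suc (length ts) ≤ length (contractL cs ++ contractL ts)
    longer rewrite ListP.length-++ (contractL cs) {contractL ts} =
      ℕP.+-mono-≤ {1} (ℕP.≤-trans (s≤s z≤n) (ℕP.≤-trans 2≤cs lcs)) lts

  contract-Branching : ∀ t → Branching t → Branching (contract t)
  contract-Branching (leaf i) _ = tt
  contract-Branching (node ts) (2≤ts , bts) with l , b ← contractL-Branching ts bts = ℕP.≤-trans 2≤ts l , b

  ∈-properClusters-contract⁻ : ∀ t {S} → S ∈ properClusters (contract t) → S ∈ properClusters t × keep S ≡ true
  ∈-properClusters-contract⁻ (node ts) = ∈-clustersL-contractL⁻ ts

  ∈-properClusters-contract⁺ : ∀ t {S} → S ∈ properClusters t → keep S ≡ true → S ∈ properClusters (contract t)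
  ∈-properClusters-contract⁺ (node ts) = ∈-clustersL-contractL⁺ ts

-- Partitions with a single non-singleton block

module _ {m : ℕ} where

  singleBlock : Subset m → Matrix m
  singleBlock S = tabulate λ i → tabulate λ j → ⌊ i Fin.≟ j ⌋ ∨ (lookup S i ∧ lookup S j)

  rel-singleBlock : ∀ (S : Subset m) i j → rel (singleBlock S) i j ≡ ⌊ i Fin.≟ j ⌋ ∨ (lookup S i ∧ lookup S j)
  rel-singleBlock S i j = trans (cong (λ row → lookup row j) (VecP.lookup∘tabulate _ i)) (VecP.lookup∘tabulate _ j)

  rel-singleBlock⁻ : ∀ (S : Subset m) {i j} → rel (singleBlock S) i j ≡ true → i ≡ j ⊎ (i ∈S S × j ∈S S)
  rel-singleBlock⁻ S {i} {j} r with i Fin.≟ j | lookup S i | lookup S j | rel-singleBlock S i j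
  ... | yes i≡j | _ | _ | _ = inj₁ i≡j
  ... | no _ | true | true | _ = inj₂ (refl , refl)
  ... | no _ | true | false | e = contradiction (trans (sym r) e) true≢false
  ... | no _ | false | _ | e = contradiction (trans (sym r) e) true≢false

  rel-singleBlock⁺ : ∀ (S : Subset m) {i j} → i ≡ j ⊎ (i ∈S S × j ∈S S) → rel (singleBlock S) i j ≡ true
  rel-singleBlock⁺ S {i} {j} h with i Fin.≟ j | lookup S i | lookup S j | rel-singleBlock S i j | h
  ... | yes _ | _ | _ | e | _ = e
  ... | no i≢j | _ | _ | _ | inj₁ i≡j = contradiction i≡j i≢j
  ... | no _ | true | true | e | inj₂ _ = e

  singleBlock-IsPartition : ∀ (S : Subset m) → IsPartition (singleBlock S)
  singleBlock-IsPartition S =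
    (λ i → rel-singleBlock⁺ S (inj₁ refl)) ,
    (λ i j r → rel-singleBlock⁺ S (symmetric (rel-singleBlock⁻ S r))) ,
    (λ i j l r r′ → rel-singleBlock⁺ S (transitive (rel-singleBlock⁻ S r) (rel-singleBlock⁻ S r′)))
    where
    symmetric : ∀ {i j} → i ≡ j ⊎ (i ∈S S × j ∈S S) → j ≡ i ⊎ (j ∈S S × i ∈S S)
    symmetric (inj₁ i≡j) = inj₁ (sym i≡j)
    symmetric (inj₂ (i∈ , j∈)) = inj₂ (j∈ , i∈)
    transitive : ∀ {i j l} → i ≡ j ⊎ (i ∈S S × j ∈S S) → j ≡ l ⊎ (j ∈S S × l ∈S S) → i ≡ l ⊎ (i ∈S S × l ∈S S)
    transitive (inj₁ refl) r = r
    transitive (inj₂ r) (inj₁ refl) = inj₂ r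
    transitive (inj₂ (i∈ , _)) (inj₂ (_ , l∈)) = inj₂ (i∈ , l∈)

  block-singleBlock-∈ : ∀ (S : Subset m) {i} → i ∈S S → block (singleBlock S) i ≡ S
  block-singleBlock-∈ S {i} i∈S =
    ⊆S-antisym (λ j r → in-S (rel-singleBlock⁻ S r)) (λ j j∈S → rel-singleBlock⁺ S (inj₂ (i∈S , j∈S)))
    where
    in-S : ∀ {j} → i ≡ j ⊎ (i ∈S S × j ∈S S) → j ∈S S
    in-S (inj₁ refl) = i∈S
    in-S (inj₂ (_ , j∈S)) = j∈S

  block-singleBlock-∉ : ∀ (S : Subset m) {i} → ¬ i ∈S S → ∣ block (singleBlock S) i ∣ ≤ 1
  block-singleBlock-∉ S {i} i∉S = ⊆-singleton⇒∣∣≤1 {S = block (singleBlock S) i} i (λ j r → is-i (rel-singleBlock⁻ S r))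
    where
    is-i : ∀ {j} → i ≡ j ⊎ (i ∈S S × j ∈S S) → j ≡ i
    is-i (inj₁ i≡j) = sym i≡j
    is-i (inj₂ (i∈S , _)) = contradiction i∈S i∉S

  singleBlock-InI : ∀ (S : Subset m) → 2 ≤ ∣ S ∣ → InI (singleBlock S)
  singleBlock-InI S 2≤∣S∣ with i₀ , i₀∈S ← 2≤∣∣⇒∃∈S {S = S} 2≤∣S∣ =
    singleBlock-IsPartition S , (i₀ , subst (λ X → 1 < ∣ X ∣) (sym (block-singleBlock-∈ S i₀∈S)) 2≤∣S∣) , unique-block
    where
    large⇒∈S : ∀ i → 1 < ∣ block (singleBlock S) i ∣ → i ∈S S
    large⇒∈S i large = decidable-stable (i ∈S? S) λ i∉S → ℕP.<⇒≱ large (block-singleBlock-∉ S i∉S)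
    unique-block : ∀ i i′ → 1 < ∣ block (singleBlock S) i ∣ → 1 < ∣ block (singleBlock S) i′ ∣ →
                   block (singleBlock S) i ≡ block (singleBlock S) i′
    unique-block i i′ large large′ =
      trans (block-singleBlock-∈ S (large⇒∈S i large)) (sym (block-singleBlock-∈ S (large⇒∈S i′ large′)))

  singleBlock-mono : ∀ {S T : Subset m} → S ⊆S T → singleBlock S ≤Π singleBlock T
  singleBlock-mono {S} {T} S⊆T i j r with rel-singleBlock⁻ S r
  ... | inj₁ i≡j = rel-singleBlock⁺ T (inj₁ i≡j)
  ... | inj₂ (i∈S , j∈S) = rel-singleBlock⁺ T (inj₂ (S⊆T i i∈S , S⊆T j j∈S))

  singleBlock-mono⁻ : ∀ {S T : Subset m} → 2 ≤ ∣ S ∣ → singleBlock S ≤Π singleBlock T → S ⊆S T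
  singleBlock-mono⁻ {S} {T} 2≤∣S∣ S≤T i i∈S with j , j∈S , j≢i ← 2≤∣∣⇒∃-other {S = S} 2≤∣S∣ i
    with rel-singleBlock⁻ T (S≤T i j (rel-singleBlock⁺ S (inj₂ (i∈S , j∈S))))
  ... | inj₁ i≡j = contradiction (sym i≡j) j≢i
  ... | inj₂ (i∈T , _) = i∈T

  singleBlock-injective : ∀ {S T : Subset m} → 2 ≤ ∣ S ∣ → 2 ≤ ∣ T ∣ → singleBlock S ≡ singleBlock T → S ≡ T
  singleBlock-injective {S} {T} 2≤∣S∣ 2≤∣T∣ e =
    ⊆S-antisym (singleBlock-mono⁻ {S} {T} 2≤∣S∣ (λ i j → subst (λ M → rel M i j ≡ true) e))
               (singleBlock-mono⁻ {T} {S} 2≤∣T∣ (λ i j → subst (λ M → rel M i j ≡ true) (sym e)))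

  rel-top : ∀ i j → rel (top m) i j ≡ true
  rel-top i j = trans (cong (λ row → lookup row j) (VecP.lookup-replicate i (replicate m true))) (VecP.lookup-replicate j true)

  singleBlock≢top : ∀ (S : Subset m) → 2 ≤ ∣ S ∣ → ∃[ i ] (¬ i ∈S S) → singleBlock S ≢ top m
  singleBlock≢top S 2≤∣S∣ (i , i∉S) e with j , j∈S ← 2≤∣∣⇒∃∈S {S = S} 2≤∣S∣
    with rel-singleBlock⁻ S (trans (cong (λ M → rel M i j) e) (rel-top i j))
  ... | inj₁ refl = i∉S j∈S
  ... | inj₂ (i∈S , _) = i∉S i∈S

  Vec-ext : ∀ {A : Set} {n} {u v : Vec A n} → (∀ i → lookup u i ≡ lookup v i) → u ≡ v
  Vec-ext {u = u} {v} same = trans (sym (VecP.tabulate∘lookup u)) (trans (VecP.tabulate-cong same) (VecP.tabulate∘lookup v))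

  Matrix-ext : ∀ (x y : Matrix m) → (∀ i j → rel x i j ≡ rel y i j) → x ≡ y
  Matrix-ext x y same = Vec-ext λ i → Vec-ext (same i)

  InI⇒singleBlock : ∀ (x : Matrix m) → InI x → ∃[ S ] (x ≡ singleBlock S × 2 ≤ ∣ S ∣)
  InI⇒singleBlock x ((refl-x , sym-x , trans-x) , (i₀ , large) , unique) =
    S , Matrix-ext x (singleBlock S) (λ i j → BoolP.⇔→≡ {z = true} (mk⇔ (⇒single i j) (single⇒ i j))) , large
    where
    S = block x i₀
    ⇒single : ∀ i j → rel x i j ≡ true → rel (singleBlock S) i j ≡ true
    ⇒single i j r with i Fin.≟ j
    ... | yes i≡j = rel-singleBlock⁺ S (inj₁ i≡j)
    ... | no i≢j = rel-singleBlock⁺ S (inj₂ (subst (i ∈S_) same (refl-x i) , subst (j ∈S_) same r))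
      where
      same : block x i ≡ S
      same = unique i i₀ (distinct-∈S⇒2≤∣∣ {S = block x i} (refl-x i) r i≢j) large
    single⇒ : ∀ i j → rel (singleBlock S) i j ≡ true → rel x i j ≡ true
    single⇒ i j r with rel-singleBlock⁻ S r
    ... | inj₁ refl = refl-x i
    ... | inj₂ (i∈S , j∈S) = trans-x i i₀ j (sym-x i₀ i i∈S) j∈S

anyFin : ∀ {n} → (Fin n → Bool) → Bool
anyFin {zero} f = false
anyFin {suc n} f = f zero ∨ anyFin (f ∘ suc)

anyFin-cong : ∀ {n} {f g : Fin n → Bool} → (∀ j → f j ≡ g j) → anyFin f ≡ anyFin g
anyFin-cong {zero} _ = refl
anyFin-cong {suc n} f≗g = cong₂ _∨_ (f≗g zero) (anyFin-cong (f≗g ∘ suc))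

anyFin-false : ∀ {n} {f : Fin n → Bool} → (∀ j → f j ≡ false) → anyFin f ≡ false
anyFin-false {zero} _ = refl
anyFin-false {suc n} f≗false rewrite f≗false zero = anyFin-false (f≗false ∘ suc)

any-allFin : ∀ {n} (f : Fin n → Bool) → any f (allFin n) ≡ anyFin f
any-allFin {n} f = trans (cong or (ListP.map-tabulate id f)) (or-tabulate f)
  where
  or-tabulate : ∀ {n} (g : Fin n → Bool) → or (List.tabulate g) ≡ anyFin g
  or-tabulate {zero} g = refl
  or-tabulate {suc n} g = cong (g zero ∨_) (or-tabulate (g ∘ suc))

∣∣-tabulate-cong : ∀ {n} {f g : Fin n → Bool} → (∀ i → f i ≡ g i) → ∣ tabulate f ∣ ≡ ∣ tabulate g ∣
∣∣-tabulate-cong f≗g = cong ∣_∣ (VecP.tabulate-cong f≗g)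

∣complement∣+∣∣≡n : ∀ {n} (U : Subset n) → ∣ tabulate (not ∘ lookup U) ∣ + ∣ U ∣ ≡ n
∣complement∣+∣∣≡n Vec.[] = refl
∣complement∣+∣∣≡n (true Vec.∷ U) = trans (ℕP.+-suc _ _) (cong suc (∣complement∣+∣∣≡n U))
∣complement∣+∣∣≡n (false Vec.∷ U) = cong suc (∣complement∣+∣∣≡n U)

leastOfBlock : ∀ {n} → Subset n → Fin n → Bool
leastOfBlock U i = not (anyFin λ j → (toℕ j ℕ.<ᵇ toℕ i) ∧ (lookup U i ∧ lookup U j))

count-leastOfBlock : ∀ {n} (U : Subset n) → ∃[ i ] (i ∈S U) → ∣ tabulate (leastOfBlock U) ∣ + ∣ U ∣ ≡ suc n
count-leastOfBlock {suc n} (true Vec.∷ U) _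
  rewrite anyFin-false {f = λ j → (toℕ j ℕ.<ᵇ 0) ∧ (true ∧ lookup (true Vec.∷ U) j)} (λ _ → refl) =
  cong suc (trans (cong (_+ suc ∣ U ∣) (∣∣-tabulate-cong outside-only))
                 (trans (ℕP.+-suc _ _) (cong suc (∣complement∣+∣∣≡n U))))
  where
  outside-only : ∀ i → leastOfBlock (true Vec.∷ U) (suc i) ≡ not (lookup U i)
  outside-only i with lookup U i
  ... | true = refl
  ... | false = cong not (anyFin-false {f = λ j → (toℕ j ℕ.<ᵇ toℕ i) ∧ (false ∧ lookup U j)} (λ _ → BoolP.∧-zeroʳ _))
count-leastOfBlock {suc n} (false Vec.∷ U) (suc i , i∈U)
  rewrite anyFin-false {f = λ j → (toℕ j ℕ.<ᵇ 0) ∧ (false ∧ lookup (false Vec.∷ U) j)} (λ _ → refl) =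
  cong suc (trans (cong (_+ ∣ U ∣) (∣∣-tabulate-cong shifted)) (count-leastOfBlock U (i , i∈U)))
  where
  shifted : ∀ i → leastOfBlock (false Vec.∷ U) (suc i) ≡ leastOfBlock U i
  shifted i = cong (λ b → not (b ∨ anyFin λ j → (toℕ j ℕ.<ᵇ toℕ i) ∧ (lookup U i ∧ lookup U j)))
                   (BoolP.∧-zeroʳ (lookup U i))

module _ {m : ℕ} where

  isLeastInBlock-singleBlock : ∀ (U : Subset m) i → isLeastInBlock (singleBlock U) i ≡ leastOfBlock U i
  isLeastInBlock-singleBlock U i =
    cong not (trans (any-allFin (λ j → (toℕ j ℕ.<ᵇ toℕ i) ∧ rel (singleBlock U) i j)) (anyFin-cong same))
    where
    same : ∀ j → ((toℕ j ℕ.<ᵇ toℕ i) ∧ rel (singleBlock U) i j) ≡ ((toℕ j ℕ.<ᵇ toℕ i) ∧ (lookup U i ∧ lookup U j))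
    same j rewrite rel-singleBlock U i j with toℕ j ℕ.<ᵇ toℕ i in j<i
    ... | false = refl
    ... | true with i Fin.≟ j
    ...   | yes refl = contradiction (ℕP.<ᵇ⇒< (toℕ i) (toℕ i) (subst T (sym j<i) tt)) (ℕP.<-irrefl refl)
    ...   | no _ = refl

  numBlocks≡∣∣ : ∀ (M : Matrix m) → numBlocks M ≡ ∣ tabulate (isLeastInBlock M) ∣
  numBlocks≡∣∣ M = length≡∣∣ {S = tabulate (isLeastInBlock M)}
    (UniqueP.filter⁺ (T? ∘ isLeastInBlock M) (UniqueP.allFin⁺ m))
    (λ i i∈ → trans (VecP.lookup∘tabulate (isLeastInBlock M) i) (proj₂ (∈-filterᵇ⁻ (isLeastInBlock M) {allFin m} i∈)))
    (λ i i∈ → ∈-filterᵇ⁺ (isLeastInBlock M) (∈P.∈-tabulate⁺ i) (trans (sym (VecP.lookup∘tabulate (isLeastInBlock M) i)) i∈))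

  +≡suc⇒∸≡∸1 : ∀ a b n → a + b ≡ suc n → n ∸ a ≡ b ∸ 1
  +≡suc⇒∸≡∸1 a zero n e rewrite ℕP.+-identityʳ a | e = ℕP.m≤n⇒m∸n≡0 (ℕP.n≤1+n n)
  +≡suc⇒∸≡∸1 a (suc b) n e rewrite ℕP.+-suc a b with refl ← e = ℕP.m+n∸m≡n a b

  rk-singleBlock : ∀ (U : Subset m) → ∃[ i ] (i ∈S U) → rk (singleBlock U) ≡ ∣ U ∣ ∸ 1
  rk-singleBlock U nonempty = +≡suc⇒∸≡∸1 (numBlocks (singleBlock U)) ∣ U ∣ m (begin
    numBlocks (singleBlock U) + ∣ U ∣                  ≡⟨ cong (_+ ∣ U ∣) (numBlocks≡∣∣ (singleBlock U)) ⟩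
    ∣ tabulate (isLeastInBlock (singleBlock U)) ∣ + ∣ U ∣ ≡⟨ cong (_+ ∣ U ∣) (∣∣-tabulate-cong (isLeastInBlock-singleBlock U)) ⟩
    ∣ tabulate (leastOfBlock U) ∣ + ∣ U ∣              ≡⟨ count-leastOfBlock U nonempty ⟩
    suc m                                              ∎)
    where open ≡.≡-Reasoning

-- Nested sets of single-block partitions

Disjoint : ∀ {m} → Subset m → Subset m → Set
Disjoint S T = ¬ Intersect S T

AllPairs-lookup : ∀ {A : Set} {R : A → A → Set} {xs : List A} {x y} → AllPairs R xs → x ∈ xs → y ∈ xs →
                  x ≡ y ⊎ R x y ⊎ R y x
AllPairs-lookup (_ ∷ _) (here refl) (here refl) = inj₁ refl
AllPairs-lookup (Rx ∷ _) (here refl) (there y∈) = inj₂ (inj₁ (All.lookup Rx y∈))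
AllPairs-lookup (Ry ∷ _) (there x∈) (here refl) = inj₂ (inj₂ (All.lookup Ry x∈))
AllPairs-lookup (_ ∷ Rs) (there x∈) (there y∈) = AllPairs-lookup Rs x∈ y∈

⊆-map⁻ : ∀ {A B : Set} (f : A → B) {xs : List B} {ys : List A} → xs ⊆ₛ List.map f ys →
         ∃[ zs ] (List.map f zs ≡ xs × zs ⊆ₛ ys)
⊆-map⁻ f {[]} _ = [] , refl , λ ()
⊆-map⁻ f {x ∷ xs} x∷xs⊆ with z , z∈ , refl ← ∈P.∈-map⁻ f (x∷xs⊆ (here refl)) | zs , refl , zs⊆ ← ⊆-map⁻ f (x∷xs⊆ ∘ there) =
  z ∷ zs , refl , λ { (here refl) → z∈ ; (there w∈) → zs⊆ w∈ }

module _ {m : ℕ} where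

  overlapping⇒≡ : ∀ {Bs : List (Subset m)} → AllPairs Disjoint Bs → ∀ {B B′} → B ∈ Bs → B′ ∈ Bs → Intersect B B′ → B ≡ B′
  overlapping⇒≡ disjoint B∈ B′∈ (i , i∈B , i∈B′) with AllPairs-lookup disjoint B∈ B′∈
  ... | inj₁ B≡B′ = B≡B′
  ... | inj₂ (inj₁ B#B′) = contradiction (i , i∈B , i∈B′) B#B′
  ... | inj₂ (inj₂ B′#B) = contradiction (i , i∈B′ , i∈B) B′#B

  blockUnion : List (Subset m) → Matrix m
  blockUnion Bs = tabulate λ i → tabulate λ j → ⌊ i Fin.≟ j ⌋ ∨ any (λ B → lookup B i ∧ lookup B j) Bs

  rel-blockUnion : ∀ (Bs : List (Subset m)) i j → rel (blockUnion Bs) i j ≡ ⌊ i Fin.≟ j ⌋ ∨ any (λ B → lookup B i ∧ lookup B j) Bs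
  rel-blockUnion Bs i j = trans (cong (λ row → lookup row j) (VecP.lookup∘tabulate _ i)) (VecP.lookup∘tabulate _ j)

  rel-blockUnion⁻ : ∀ (Bs : List (Subset m)) {i j} → rel (blockUnion Bs) i j ≡ true → i ≡ j ⊎ ∃[ B ] (B ∈ Bs × i ∈S B × j ∈S B)
  rel-blockUnion⁻ Bs {i} {j} r with i Fin.≟ j | rel-blockUnion Bs i j
  ... | yes i≡j | _ = inj₁ i≡j
  ... | no _ | e with B , B∈ , ij∈B ← any⁻ (λ B → lookup B i ∧ lookup B j) Bs (trans (sym e) r) =
    inj₂ (B , B∈ , BoolP.∧-conicalˡ _ _ ij∈B , BoolP.∧-conicalʳ _ _ ij∈B)

  rel-blockUnion⁺ : ∀ (Bs : List (Subset m)) {i j} → i ≡ j ⊎ ∃[ B ] (B ∈ Bs × i ∈S B × j ∈S B) → rel (blockUnion Bs) i j ≡ true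
  rel-blockUnion⁺ Bs {i} {j} (inj₁ i≡j) rewrite rel-blockUnion Bs i j | ⌊⌋≡true (i Fin.≟ j) i≡j = refl
  rel-blockUnion⁺ Bs {i} {j} (inj₂ (B , B∈ , i∈B , j∈B)) rewrite rel-blockUnion Bs i j =
    trans (cong (⌊ i Fin.≟ j ⌋ ∨_) (any⁺ (λ B → lookup B i ∧ lookup B j) B∈ (cong₂ _∧_ i∈B j∈B))) (BoolP.∨-zeroʳ _)

  blockUnion-IsPartition : ∀ (Bs : List (Subset m)) → AllPairs Disjoint Bs → IsPartition (blockUnion Bs)
  blockUnion-IsPartition Bs disjoint = (λ i → rel-blockUnion⁺ Bs (inj₁ refl)) , symmetric , transitive
    where
    symmetric : ∀ i j → rel (blockUnion Bs) i j ≡ true → rel (blockUnion Bs) j i ≡ true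
    symmetric i j r with rel-blockUnion⁻ Bs r
    ... | inj₁ i≡j = rel-blockUnion⁺ Bs (inj₁ (sym i≡j))
    ... | inj₂ (B , B∈ , i∈B , j∈B) = rel-blockUnion⁺ Bs (inj₂ (B , B∈ , j∈B , i∈B))
    transitive : ∀ i j l → rel (blockUnion Bs) i j ≡ true → rel (blockUnion Bs) j l ≡ true → rel (blockUnion Bs) i l ≡ true
    transitive i j l r r′ with rel-blockUnion⁻ Bs r | rel-blockUnion⁻ Bs r′
    ... | inj₁ refl | _ = r′
    ... | inj₂ _ | inj₁ refl = r
    ... | inj₂ (B , B∈ , i∈B , j∈B) | inj₂ (B′ , B′∈ , j∈B′ , l∈B′)
      with refl ← overlapping⇒≡ disjoint B∈ B′∈ (j , j∈B , j∈B′) = rel-blockUnion⁺ Bs (inj₂ (B , B∈ , i∈B , l∈B′))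

  singleBlock≤blockUnion : ∀ (Bs : List (Subset m)) {B} → B ∈ Bs → singleBlock B ≤Π blockUnion Bs
  singleBlock≤blockUnion Bs {B} B∈ i j r with rel-singleBlock⁻ B r
  ... | inj₁ i≡j = rel-blockUnion⁺ Bs (inj₁ i≡j)
  ... | inj₂ (i∈B , j∈B) = rel-blockUnion⁺ Bs (inj₂ (B , B∈ , i∈B , j∈B))

  block-⊇ : ∀ {B : Subset m} {z} → singleBlock B ≤Π z → ∀ {i} → i ∈S B → B ⊆S block z i
  block-⊇ {B} B≤z i∈B j j∈B = B≤z _ j (rel-singleBlock⁺ B (inj₂ (i∈B , j∈B)))

  disjoint-blocks⇒join∉I : ∀ (Bs : List (Subset m)) → 2 ≤ length Bs → (∀ {B} → B ∈ Bs → 2 ≤ ∣ B ∣) → AllPairs Disjoint Bs →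
                           ∀ z → IsJoin (List.map singleBlock Bs) z → ¬ InI z
  disjoint-blocks⇒join∉I Bs@(B₁ ∷ B₂ ∷ _) (s≤s (s≤s z≤n)) large disjoint@((B₁#B₂ ∷ _) ∷ _) z (_ , upper , least)
                         ((refl-z , _ , _) , _ , unique-z)
    with a , a∈B₁ ← 2≤∣∣⇒∃∈S {S = B₁} (large (here refl)) | b , b∈B₂ ← 2≤∣∣⇒∃∈S {S = B₂} (large (there (here refl)))
    with rel-blockUnion⁻ Bs (least (blockUnion Bs) (blockUnion-IsPartition Bs disjoint) upper-bound a b z-ab)
    where
    upper-bound : ∀ {x} → x ∈ List.map singleBlock Bs → x ≤Π blockUnion Bs
    upper-bound x∈ with B , B∈ , refl ← ∈P.∈-map⁻ singleBlock x∈ = singleBlock≤blockUnion Bs B∈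
    large-block : ∀ {B i} → B ∈ Bs → i ∈S B → 1 < ∣ block z i ∣
    large-block {B} {i} B∈ i∈B =
      ℕP.≤-trans (large B∈) (∣∣-mono-⊆S {S = B} {block z i} (block-⊇ {B} {z} (upper (∈P.∈-map⁺ singleBlock B∈)) i∈B))
    z-ab : rel z a b ≡ true
    z-ab = subst (b ∈S_) (unique-z b a (large-block (there (here refl)) b∈B₂) (large-block (here refl) a∈B₁)) (refl-z b)
  ... | inj₁ refl = B₁#B₂ (a , a∈B₁ , b∈B₂)
  ... | inj₂ (B , B∈ , a∈B , b∈B) with refl ← overlapping⇒≡ disjoint B∈ (here refl) (a , a∈B , a∈B₁) =
    B₁#B₂ (b , b∈B , b∈B₂)

  incomparable⇒disjoint : ∀ {Bs : List (Subset m)} → Laminar Bs →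
    AllPairs (λ S T → Incomparable (singleBlock S) (singleBlock T)) Bs → AllPairs Disjoint Bs
  incomparable⇒disjoint {[]} _ [] = []
  incomparable⇒disjoint {B ∷ Bs} laminar (incomparable ∷ rest) =
    All.tabulate (λ {B′} B′∈ B∩B′ → disjoint {B′} (All.lookup incomparable B′∈) (laminar (here refl) (there B′∈) B∩B′)) ∷
    incomparable⇒disjoint (λ S∈ T∈ → laminar (there S∈) (there T∈)) rest
    where
    disjoint : ∀ {B′} → Incomparable (singleBlock B) (singleBlock B′) → B ⊆S B′ ⊎ B′ ⊆S B → ⊥
    disjoint {B′} (B≰B′ , _) (inj₁ B⊆B′) = B≰B′ (singleBlock-mono {S = B} {T = B′} B⊆B′)
    disjoint {B′} (_ , B′≰B) (inj₂ B′⊆B) = B′≰B (singleBlock-mono {S = B′} {T = B} B′⊆B)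

  laminar⇒nested : ∀ (Ss : List (Subset m)) → (∀ {S} → S ∈ Ss → 2 ≤ ∣ S ∣) → Laminar Ss →
    ∀ xs → xs ⊆ₛ List.map singleBlock Ss → 2 ≤ length xs → AllPairs Incomparable xs → ∀ z → IsJoin xs z → ¬ InI z
  laminar⇒nested Ss large laminar xs xs⊆ 2≤xs incomparable
    with Bs , refl , Bs⊆Ss ← ⊆-map⁻ singleBlock xs⊆ =
    disjoint-blocks⇒join∉I Bs (subst (2 ≤_) (ListP.length-map singleBlock Bs) 2≤xs) (large ∘ Bs⊆Ss)
      (incomparable⇒disjoint (λ S∈ T∈ → laminar (Bs⊆Ss S∈) (Bs⊆Ss T∈)) (AllPairsP.map⁻ incomparable))

  ∈S-∪ : ∀ (S T : Subset m) i → lookup (S ∪ T) i ≡ lookup S i ∨ lookup T i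
  ∈S-∪ S T i = VecP.lookup-zipWith _∨_ i S T

  nested⇒laminar : ∀ (N : List (Matrix m)) → INested N → ∀ {S T} → singleBlock S ∈ N → singleBlock T ∈ N →
    2 ≤ ∣ S ∣ → 2 ≤ ∣ T ∣ → Intersect S T → S ⊆S T ⊎ T ⊆S S
  nested⇒laminar N (_ , nested) {S} {T} S∈N T∈N 2≤∣S∣ 2≤∣T∣ (c , c∈S , c∈T) with S ⊆S? T | T ⊆S? S
  ... | yes S⊆T | _ = inj₁ S⊆T
  ... | no _ | yes T⊆S = inj₂ T⊆S
  ... | no S⊈T | no T⊈S = ⊥-elim (
    nested pair pair⊆N (s≤s (s≤s z≤n)) incomparable (singleBlock (S ∪ T)) isJoin
      (singleBlock-InI (S ∪ T) (ℕP.≤-trans 2≤∣S∣ (∣∣-mono-⊆S {S = S} {S ∪ T} ∪-upperˡ))))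
    where
    pair = singleBlock S ∷ singleBlock T ∷ []
    pair⊆N : pair ⊆ₛ N
    pair⊆N (here refl) = S∈N
    pair⊆N (there (here refl)) = T∈N
    incomparable : AllPairs Incomparable pair
    incomparable = ((S⊈T ∘ singleBlock-mono⁻ {S = S} {T = T} 2≤∣S∣ ,
                     T⊈S ∘ singleBlock-mono⁻ {S = T} {T = S} 2≤∣T∣) ∷ []) ∷ [] ∷ []
    ∪-upperˡ : S ⊆S S ∪ T
    ∪-upperˡ i i∈S = trans (∈S-∪ S T i) (cong (_∨ lookup T i) i∈S)
    ∪-upperʳ : T ⊆S S ∪ T
    ∪-upperʳ i i∈T = trans (∈S-∪ S T i) (trans (cong (lookup S i ∨_) i∈T) (BoolP.∨-zeroʳ _))
    isJoin : IsJoin pair (singleBlock (S ∪ T))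
    isJoin = singleBlock-IsPartition (S ∪ T) , upper , least
      where
      upper : ∀ {x} → x ∈ pair → x ≤Π singleBlock (S ∪ T)
      upper (here refl) = singleBlock-mono {S = S} {T = S ∪ T} ∪-upperˡ
      upper (there (here refl)) = singleBlock-mono {S = T} {T = S ∪ T} ∪-upperʳ
      least : ∀ z → IsPartition z → (∀ {x} → x ∈ pair → x ≤Π z) → singleBlock (S ∪ T) ≤Π z
      least z (refl-z , _ , trans-z) bound i j r with rel-singleBlock⁻ (S ∪ T) r
      ... | inj₁ refl = refl-z i
      ... | inj₂ (i∈ , j∈) with ∨≡true⁻ (trans (sym (∈S-∪ S T i)) i∈) | ∨≡true⁻ (trans (sym (∈S-∪ S T j)) j∈)
      ...   | inj₁ i∈S | inj₁ j∈S = S≤z i j (rel-singleBlock⁺ S (inj₂ (i∈S , j∈S)))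
        where S≤z = bound (here refl)
      ...   | inj₂ i∈T | inj₂ j∈T = bound (there (here refl)) i j (rel-singleBlock⁺ T (inj₂ (i∈T , j∈T)))
      ...   | inj₁ i∈S | inj₂ j∈T = trans-z i c j (bound (here refl) i c (rel-singleBlock⁺ S (inj₂ (i∈S , c∈S))))
                                                   (bound (there (here refl)) c j (rel-singleBlock⁺ T (inj₂ (c∈T , j∈T))))
      ...   | inj₂ i∈T | inj₁ j∈S = trans-z i c j (bound (there (here refl)) i c (rel-singleBlock⁺ T (inj₂ (i∈T , c∈T))))
                                                   (bound (here refl) c j (rel-singleBlock⁺ S (inj₂ (c∈S , j∈S))))

-- k-trees

∸1-split : ∀ a d → 1 ≤ d → d ≤ a → a ∸ 1 ≡ (a ∸ d) + (d ∸ 1)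
∸1-split (suc a) (suc d) _ (s≤s d≤a) = sym (ℕP.m∸n+n≡m d≤a)

+-∸-suc : ∀ a b d → 1 ≤ a → d ≤ b → (a + b) ∸ suc d ≡ (a ∸ 1) + (b ∸ d)
+-∸-suc (suc a) b d _ d≤b = ℕP.+-∸-assoc a d≤b

+≡⇒∸1 : ∀ a b d → a + b ≡ d → 1 ≤ a → d ∸ 1 ≡ (a ∸ 1) + b
+≡⇒∸1 (suc a) b d refl _ = refl

module _ {m : ℕ} (k : ℕ) where

  mutual
    DegOK⇒k∣leaves∸1 : ∀ (t : Tree m) → DegOK k t → 1 ≤ length (leaves t) × k ∣ length (leaves t) ∸ 1
    DegOK⇒k∣leaves∸1 (leaf i) _ = s≤s z≤n , (k ∣0)
    DegOK⇒k∣leaves∸1 (node ts) (1<ts , k∣ts∸1 , dts) with ts≤ , k∣ ← DegOKL⇒k∣leavesL∸length ts dts =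
      ℕP.≤-trans (ℕP.<⇒≤ 1<ts) ts≤ ,
      subst (k ∣_) (sym (∸1-split (length (leavesL ts)) (length ts) (ℕP.<⇒≤ 1<ts) ts≤)) (∣m∣n⇒∣m+n k∣ k∣ts∸1)

    DegOKL⇒k∣leavesL∸length : ∀ (ts : List (Tree m)) → DegOKL k ts →
                              length ts ≤ length (leavesL ts) × k ∣ length (leavesL ts) ∸ length ts
    DegOKL⇒k∣leavesL∸length [] _ = z≤n , (k ∣0)
    DegOKL⇒k∣leavesL∸length (c ∷ ts) (dc , dts)
      with 1≤c , k∣c ← DegOK⇒k∣leaves∸1 c dc | ts≤ , k∣ts ← DegOKL⇒k∣leavesL∸length ts dts
      rewrite ListP.length-++ (leaves c) {leavesL ts} =
      ℕP.+-mono-≤ 1≤c ts≤ ,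
      subst (k ∣_) (sym (+-∸-suc (length (leaves c)) (length (leavesL ts)) (length ts) 1≤c ts≤)) (∣m∣n⇒∣m+n k∣c k∣ts)

  DegOKL-∈ : ∀ {ts : List (Tree m)} {c} → DegOKL k ts → c ∈ ts → DegOK k c
  DegOKL-∈ (dc , _) (here refl) = dc
  DegOKL-∈ (_ , dts) (there c∈) = DegOKL-∈ dts c∈

  DegOKL-filterᵇ : ∀ (p : Tree m → Bool) ts → DegOKL k ts → DegOKL k (filterᵇ p ts)
  DegOKL-filterᵇ p [] _ = tt
  DegOKL-filterᵇ p (c ∷ ts) (dc , dts) with p c
  ... | true = dc , DegOKL-filterᵇ p ts dts
  ... | false = DegOKL-filterᵇ p ts dts

  ⊑-DegOK : ∀ {d t : Tree m} → d ⊑ t → DegOK k t → DegOK k d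
  ⊑-DegOK self dt = dt
  ⊑-DegOK (child c∈ d⊑c) (_ , _ , dts) = ⊑-DegOK d⊑c (DegOKL-∈ dts c∈)

  mutual
    DegOK⇒Branching : ∀ (t : Tree m) → DegOK k t → Branching t
    DegOK⇒Branching (leaf i) _ = tt
    DegOK⇒Branching (node ts) (1<ts , _ , dts) = 1<ts , DegOKL⇒BranchingL ts dts

    DegOKL⇒BranchingL : ∀ (ts : List (Tree m)) → DegOKL k ts → BranchingL ts
    DegOKL⇒BranchingL [] _ = tt
    DegOKL⇒BranchingL (t ∷ ts) (dt , dts) = DegOK⇒Branching t dt , DegOKL⇒BranchingL ts dts

  clusters-k∣∣∣∸1 : ∀ (t : Tree m) {S} → Unique (leaves t) → DegOK k t → S ∈ clusters t → k ∣ ∣ S ∣ ∸ 1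
  clusters-k∣∣∣∸1 t u dt S∈ with ds , refl , ds⊑t ← clusters-⊑ t S∈ =
    subst (λ n → k ∣ n ∸ 1) (length≡∣∣ {S = leafSet (node ds)} (⊑-Unique ds⊑t u) (λ _ → ∈leafSet⁺ (node ds)) (λ _ → ∈leafSet⁻ (node ds)))
          (proj₂ (DegOK⇒k∣leaves∸1 (node ds) (⊑-DegOK ds⊑t dt)))

  properClusters-k∣∣∣∸1 : ∀ (t : Tree m) {S} → Unique (leaves t) → DegOK k t → S ∈ properClusters t → k ∣ ∣ S ∣ ∸ 1
  properClusters-k∣∣∣∸1 (node ts) u dt = clusters-k∣∣∣∸1 (node ts) u dt ∘ there

filterᵇ-leavesL : ∀ {m} (p : Tree m → Bool) ts → leavesL (filterᵇ p ts) ++ leavesL (filterᵇ (not ∘ p) ts) ↭ leavesL ts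
filterᵇ-leavesL p [] = ↭-refl
filterᵇ-leavesL p (c ∷ ts) with p c
... | true = ↭-trans (↭.↭-reflexive (ListP.++-assoc (leaves c) _ _)) (↭P.++⁺ˡ (leaves c) (filterᵇ-leavesL p ts))
... | false = ↭-trans (↭P.shifts (leavesL (filterᵇ p ts)) (leaves c)) (↭P.++⁺ˡ (leaves c) (filterᵇ-leavesL p ts))

-- S is inserted at the lowest vertex whose cluster contains it: the children of that vertex lying
-- inside S are grouped under a new vertex.  Both the new vertex and the old one keep an outdegree
-- ≡ 1 (mod k) because ∣S∣ and the leaf count of every child are ≡ 1 (mod k).
module Insertion {m : ℕ} (k : ℕ) (S : Subset m) (2≤∣S∣ : 2 ≤ ∣ S ∣) (k∣∣S∣∸1 : k ∣ ∣ S ∣ ∸ 1) where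

  inside : Tree m → Bool
  inside c = ⌊ leafSet c ⊆S? S ⌋

  contains : Tree m → Bool
  contains (leaf _) = false
  contains (node cs) = ⌊ S ⊆S? leafSet (node cs) ⌋

  mutual
    insertAt : Bool → List (Tree m) → List (Tree m)
    insertAt true ts = insertBelow ts
    insertAt false ts = node (filterᵇ inside ts) ∷ filterᵇ (not ∘ inside) ts

    insertBelow : List (Tree m) → List (Tree m)
    insertBelow [] = []
    insertBelow (c ∷ ts) = insertInto c ∷ insertBelow ts

    insertInto : Tree m → Tree m
    insertInto (leaf i) = leaf i
    insertInto (node cs) = insertInto′ (contains (node cs) ∧ not ⌊ S ≟S leafSet (node cs) ⌋) cs

    insertInto′ : Bool → List (Tree m) → Tree m
    insertInto′ true cs = node (insertAt (any contains cs) cs)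
    insertInto′ false cs = node cs

  LaminarWithS : List (Subset m) → Set
  LaminarWithS Ts = ∀ {T} → T ∈ Ts → Intersect S T → S ⊆S T ⊎ T ⊆S S

  record Insertable (ts : List (Tree m)) : Set where
    constructor insertable
    field
      unique : Unique (leavesL ts)
      degOK : DegOK k (node ts)
      S⊆leaves : ∀ i → i ∈S S → i ∈ leavesL ts
      S-proper : ∃[ i ] (i ∈ leavesL ts × ¬ i ∈S S)
      laminar : LaminarWithS (clusters (node ts))

  record Inserted (ts ys : List (Tree m)) : Set where
    constructor inserted
    field
      leaves↭ : leavesL ys ↭ leavesL ts
      degOK : DegOK k (node ys)
      new⊆ : clustersL ys ⊆ₛ (S ∷ clustersL ts)
      old⊆ : clustersL ts ⊆ₛ clustersL ys
      S∈ : S ∈ clustersL ys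

  record InsertedInto (c c′ : Tree m) : Set where
    constructor insertedInto
    field
      leaves↭ : leaves c′ ↭ leaves c
      degOK : DegOK k c′
      new⊆ : clusters c′ ⊆ₛ (S ∷ clusters c)
      old⊆ : clusters c ⊆ₛ clusters c′
      S∈ : contains c ≡ true → S ∈ clusters c′

  record InsertedBelow (ts ys : List (Tree m)) : Set where
    constructor insertedBelow
    field
      leaves↭ : leavesL ys ↭ leavesL ts
      degOK : DegOKL k ys
      length≡ : length ys ≡ length ts
      new⊆ : clustersL ys ⊆ₛ (S ∷ clustersL ts)
      old⊆ : clustersL ts ⊆ₛ clustersL ys
      S∈ : any contains ts ≡ true → S ∈ clustersL ys

  module Grouping {ts : List (Tree m)} (ins : Insertable ts) (no-child-contains : any contains ts ≡ false) where

    open Insertable ins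

    inner outer : List (Tree m)
    inner = filterᵇ inside ts
    outer = filterᵇ (not ∘ inside) ts

    ¬contains : ∀ {c} → c ∈ ts → ¬ S ⊆S leafSet c
    ¬contains {leaf i} _ S⊆i with a , a∈S , a≢i ← 2≤∣∣⇒∃-other {S = S} 2≤∣S∣ i
      with here a≡i ← ∈leafSet⁻ (leaf i) (S⊆i a a∈S) = a≢i a≡i
    ¬contains {node cs} c∈ S⊆c =
      true≢false (trans (sym (any⁺ contains c∈ (⌊⌋≡true (S ⊆S? leafSet (node cs)) S⊆c))) no-child-contains)

    child-⊆S : ∀ {i c} → i ∈S S → c ∈ ts → i ∈ leaves c → leafSet c ⊆S S
    child-⊆S {i} {leaf j} i∈S _ (here refl) x x∈ with here refl ← ∈leafSet⁻ (leaf j) x∈ = i∈S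
    child-⊆S {i} {node cs} i∈S c∈ i∈c
      with laminar (there (∈-clustersL⁺ c∈ (here refl))) (i , i∈S , ∈leafSet⁺ (node cs) i∈c)
    ... | inj₁ S⊆c = contradiction S⊆c (¬contains c∈)
    ... | inj₂ c⊆S = c⊆S

    child∈inner : ∀ {i c} → i ∈S S → c ∈ ts → i ∈ leaves c → c ∈ inner
    child∈inner {c = c} i∈S c∈ i∈c = ∈-filterᵇ⁺ inside c∈ (⌊⌋≡true (leafSet c ⊆S? S) (child-⊆S i∈S c∈ i∈c))

    inner-leaves⊆S : ∀ i → i ∈ leavesL inner → i ∈S S
    inner-leaves⊆S i i∈ with c , c∈ , i∈c ← ∈-leavesL⁻ {ts = inner} i∈ =
      witness⌊⌋ (leafSet c ⊆S? S) (proj₂ (∈-filterᵇ⁻ inside {ts} c∈)) i (∈leafSet⁺ c i∈c)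

    S⊆inner-leaves : ∀ i → i ∈S S → i ∈ leavesL inner
    S⊆inner-leaves i i∈S with c , c∈ , i∈c ← ∈-leavesL⁻ {ts = ts} (S⊆leaves i i∈S) =
      ∈-leavesL⁺ inner (child∈inner i∈S c∈ i∈c) i∈c

    leafSet-inner : leafSet (node inner) ≡ S
    leafSet-inner = ⊆S-antisym (λ i i∈ → inner-leaves⊆S i (∈leafSet⁻ (node inner) i∈))
                               (λ i i∈S → ∈leafSet⁺ (node inner) (S⊆inner-leaves i i∈S))

    inner-outer↭ : leavesL inner ++ leavesL outer ↭ leavesL ts
    inner-outer↭ = filterᵇ-leavesL inside ts

    length-inner-leaves : length (leavesL inner) ≡ ∣ S ∣
    length-inner-leaves =
      length≡∣∣ {S = S} (Unique-++⁻ˡ (leavesL inner) (Unique-resp-↭ (↭-sym inner-outer↭) unique)) inner-leaves⊆S S⊆inner-leaves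

    2≤inner : 2 ≤ length inner
    2≤inner with i , i∈S ← 2≤∣∣⇒∃∈S {S = S} 2≤∣S∣
      with c , c∈ , i∈c ← ∈-leavesL⁻ {ts = ts} (S⊆leaves i i∈S)
      with j , j∈S , j∉c ← ⊈S⇒∃ {S = S} {T = leafSet c} (¬contains c∈)
      with d , d∈ , j∈d ← ∈-leavesL⁻ {ts = ts} (S⊆leaves j j∈S) =
      distinct-∈⇒2≤length (child∈inner i∈S c∈ i∈c) (child∈inner j∈S d∈ j∈d)
        λ { refl → j∉c (∈leafSet⁺ c j∈d) }

    k∣inner∸1 : k ∣ length inner ∸ 1
    k∣inner∸1 with inner≤ , k∣ ← DegOKL⇒k∣leavesL∸length k inner (DegOKL-filterᵇ k inside ts (proj₂ (proj₂ degOK))) =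
      ∣m+n∣m⇒∣n (subst (k ∣_) (∸1-split ∣ S ∣ (length inner) (ℕP.≤-trans (s≤s z≤n) 2≤inner) inner≤S) k∣∣S∣∸1)
                (subst (λ n → k ∣ n ∸ length inner) length-inner-leaves k∣)
      where
      inner≤S : length inner ≤ ∣ S ∣
      inner≤S = subst (length inner ≤_) length-inner-leaves inner≤

    1≤outer : 1 ≤ length outer
    1≤outer with i , i∈ , i∉S ← S-proper with c , c∈ , i∈c ← ∈-leavesL⁻ {ts = ts} i∈ =
      ∈⇒1≤length (∈-filterᵇ⁺ (not ∘ inside) c∈ (cong not c-outside))
      where
      c-outside : inside c ≡ false
      c-outside with leafSet c ⊆S? S
      ... | yes c⊆S = contradiction (c⊆S i (∈leafSet⁺ c i∈c)) i∉S
      ... | no _ = refl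

    k∣outer : k ∣ length outer
    k∣outer = ∣m+n∣m⇒∣n (subst (k ∣_) (+≡⇒∸1 (length inner) (length outer) (length ts) (length-filterᵇ-split inside ts)
                                              (ℕP.≤-trans (s≤s z≤n) 2≤inner))
                                      (proj₁ (proj₂ degOK)))
                        k∣inner∸1

    new⊆ : clustersL (node inner ∷ outer) ⊆ₛ (S ∷ clustersL ts)
    new⊆ (here refl) = here leafSet-inner
    new⊆ (there T∈) with ∈P.∈-++⁻ (clustersL inner) T∈
    ... | inj₁ T∈inner with c , c∈ , T∈c ← ∈-clustersL⁻ {ts = inner} T∈inner =
      there (∈-clustersL⁺ (proj₁ (∈-filterᵇ⁻ inside {ts} c∈)) T∈c)
    ... | inj₂ T∈outer with c , c∈ , T∈c ← ∈-clustersL⁻ {ts = outer} T∈outer =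
      there (∈-clustersL⁺ (proj₁ (∈-filterᵇ⁻ (not ∘ inside) {ts} c∈)) T∈c)

    old⊆ : clustersL ts ⊆ₛ clustersL (node inner ∷ outer)
    old⊆ T∈ with c , c∈ , T∈c ← ∈-clustersL⁻ {ts = ts} T∈ with inside c in c-inside
    ... | true = there (∈P.∈-++⁺ˡ (∈-clustersL⁺ (∈-filterᵇ⁺ inside c∈ c-inside) T∈c))
    ... | false = there (∈P.∈-++⁺ʳ (clustersL inner) (∈-clustersL⁺ (∈-filterᵇ⁺ (not ∘ inside) c∈ (cong not c-inside)) T∈c))

    grouped : Inserted ts (insertAt false ts)
    grouped = inserted inner-outer↭
      (s≤s 1≤outer , k∣outer , (2≤inner , k∣inner∸1 , DegOKL-filterᵇ k inside ts (proj₂ (proj₂ degOK))) ,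
                                DegOKL-filterᵇ k (not ∘ inside) ts (proj₂ (proj₂ degOK)))
      new⊆ old⊆ (here (sym leafSet-inner))

  mutual
    insertAt-correct : ∀ b ts → b ≡ any contains ts → Insertable ts → Inserted ts (insertAt b ts)
    insertAt-correct false ts b≡ ins = Grouping.grouped ins (sym b≡)
    insertAt-correct true ts b≡ (insertable u (1<ts , k∣ts∸1 , dts) _ _ laminar)
      with insertedBelow ys↭ dys length≡ new⊆ old⊆ S∈ ← insertBelow-correct ts u dts (laminar ∘ there) =
      inserted ys↭ (subst (1 <_) (sym length≡) 1<ts , subst (λ n → k ∣ n ∸ 1) (sym length≡) k∣ts∸1 , dys)
               new⊆ old⊆ (S∈ (sym b≡))

    insertBelow-correct : ∀ ts → Unique (leavesL ts) → DegOKL k ts → LaminarWithS (clustersL ts) →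
                          InsertedBelow ts (insertBelow ts)
    insertBelow-correct [] _ _ _ = insertedBelow ↭-refl tt refl (λ ()) (λ ()) (λ ())
    insertBelow-correct (c ∷ ts) u (dc , dts) laminar
      with insertedInto c↭ dc′ newc⊆ oldc⊆ S∈c ← insertInto-correct c (Unique-++⁻ˡ (leaves c) u) dc (laminar ∘ ∈P.∈-++⁺ˡ)
         | insertedBelow ts↭ dts′ length≡ newts⊆ oldts⊆ S∈ts
             ← insertBelow-correct ts (Unique-++⁻ʳ (leaves c) u) dts (laminar ∘ ∈P.∈-++⁺ʳ (clusters c)) =
      insertedBelow (↭P.++⁺ c↭ ts↭) (dc′ , dts′) (cong suc length≡) (++⁺-∷ newc⊆ newts⊆) (⊆P.++⁺ oldc⊆ oldts⊆) S∈
      where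
      S∈ : any contains (c ∷ ts) ≡ true → S ∈ clustersL (insertInto c ∷ insertBelow ts)
      S∈ h with ∨≡true⁻ {contains c} h
      ... | inj₁ hc = ∈P.∈-++⁺ˡ (S∈c hc)
      ... | inj₂ hts = ∈P.∈-++⁺ʳ (clusters (insertInto c)) (S∈ts hts)

    insertInto-correct : ∀ c → Unique (leaves c) → DegOK k c → LaminarWithS (clusters c) → InsertedInto c (insertInto c)
    insertInto-correct (leaf i) _ dc _ = insertedInto ↭-refl dc there id (λ ())
    insertInto-correct (node cs) = insertInto′-correct _ cs refl

    insertInto′-correct : ∀ b cs → b ≡ (contains (node cs) ∧ not ⌊ S ≟S leafSet (node cs) ⌋) → Unique (leavesL cs) →
                          DegOK k (node cs) → LaminarWithS (clusters (node cs)) → InsertedInto (node cs) (insertInto′ b cs)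
    insertInto′-correct false cs b≡ u dc laminar = insertedInto ↭-refl dc there id S∈
      where
      S∈ : contains (node cs) ≡ true → S ∈ clusters (node cs)
      S∈ h with ∧≡false⁻ (sym b≡)
      ... | inj₁ h′ = contradiction (trans (sym h) h′) true≢false
      ... | inj₂ h′ = here (witness⌊⌋ (S ≟S leafSet (node cs)) (BoolP.not-injective h′))
    insertInto′-correct true cs b≡ u dc laminar =
      into (insertAt-correct (any contains cs) cs refl (insertable u dc S⊆cs S-proper laminar))
      where
      S⊆c : S ⊆S leafSet (node cs)
      S⊆c = witness⌊⌋ (S ⊆S? leafSet (node cs)) (BoolP.∧-conicalˡ _ _ (sym b≡))
      S≢c : S ≢ leafSet (node cs)
      S≢c = refute⌊⌋ (S ≟S leafSet (node cs)) (BoolP.not-injective (BoolP.∧-conicalʳ _ _ (sym b≡)))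
      S⊆cs : ∀ i → i ∈S S → i ∈ leavesL cs
      S⊆cs i i∈S = ∈leafSet⁻ (node cs) (S⊆c i i∈S)
      S-proper : ∃[ i ] (i ∈ leavesL cs × ¬ i ∈S S)
      S-proper with j , j∈ , j∉S ← ⊈S⇒∃ {S = leafSet (node cs)} {T = S} (S≢c ∘ ⊆S-antisym S⊆c) =
        j , ∈leafSet⁻ (node cs) j∈ , j∉S
      into : ∀ {ys} → Inserted cs ys → InsertedInto (node cs) (node ys)
      into {ys} (inserted ys↭ dys new⊆ old⊆ S∈) = insertedInto ys↭ dys new′⊆ old′⊆ (λ _ → there S∈)
        where
        same : leafSet (node ys) ≡ leafSet (node cs)
        same = leafSet-↭ ys cs ys↭
        new′⊆ : clusters (node ys) ⊆ₛ (S ∷ clusters (node cs))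
        new′⊆ (here refl) = there (here same)
        new′⊆ (there T∈) with new⊆ T∈
        ... | here T≡S = here T≡S
        ... | there T∈cs = there (there T∈cs)
        old′⊆ : clusters (node cs) ⊆ₛ clusters (node ys)
        old′⊆ (here refl) = here (sym same)
        old′⊆ (there T∈) = there (old⊆ T∈)

module Realization {m : ℕ} (k : ℕ) (Ss : List (Subset m))
                   (large : ∀ {S} → S ∈ Ss → 2 ≤ ∣ S ∣) (k∣ : ∀ {S} → S ∈ Ss → k ∣ ∣ S ∣ ∸ 1)
                   (proper : ∀ {S} → S ∈ Ss → ∃[ i ] (¬ i ∈S S)) (laminar : Laminar Ss) where

  Realized : List (Subset m) → List (Tree m) → Set
  Realized Rs ts = ∃[ ys ] (leavesL ys ↭ allFin m × DegOK k (node ys) ×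
                            clustersL ys ⊆ₛ Ss × Rs ⊆ₛ clustersL ys × clustersL ts ⊆ₛ clustersL ys)

  insertAll : ∀ Rs → Rs ⊆ₛ Ss → ∀ ts → leavesL ts ↭ allFin m → DegOK k (node ts) → clustersL ts ⊆ₛ Ss → Realized Rs ts
  insertAll [] _ ts ts↭ dts ts⊆Ss = ts , ts↭ , dts , ts⊆Ss , (λ ()) , id
  insertAll (R ∷ Rs) R∷Rs⊆Ss ts ts↭ dts ts⊆Ss = continue (I.insertAt-correct (any I.contains ts) ts refl insertable-ts)
    where
    R∈Ss = R∷Rs⊆Ss (here refl)
    module I = Insertion k R (large R∈Ss) (k∣ R∈Ss)
    all∈ : ∀ i → i ∈ leavesL ts
    all∈ i = ↭P.∈-resp-↭ (↭-sym ts↭) (∈P.∈-tabulate⁺ i)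
    laminar-R : I.LaminarWithS (clusters (node ts))
    laminar-R (here refl) _ = inj₁ (λ i _ → ∈leafSet⁺ (node ts) (all∈ i))
    laminar-R (there T∈) R∩T = laminar R∈Ss (ts⊆Ss T∈) R∩T
    insertable-ts : I.Insertable ts
    insertable-ts = I.insertable (Unique-resp-↭ (↭-sym ts↭) (UniqueP.allFin⁺ m)) dts (λ i _ → all∈ i)
                                 (let (i , i∉R) = proper R∈Ss in i , all∈ i , i∉R) laminar-R
    continue : ∀ {ys} → I.Inserted ts ys → Realized (R ∷ Rs) ts
    continue {ys} (I.inserted ys↭ dys new⊆ old⊆ R∈ys) =
      extend (insertAll Rs (R∷Rs⊆Ss ∘ there) ys (↭-trans ys↭ ts↭) dys ys⊆Ss)
      where
      ys⊆Ss : clustersL ys ⊆ₛ Ss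
      ys⊆Ss T∈ with new⊆ T∈
      ... | here refl = R∈Ss
      ... | there T∈ts = ts⊆Ss T∈ts
      extend : Realized Rs ys → Realized (R ∷ Rs) ts
      extend (zs , zs↭ , dzs , zs⊆Ss , Rs⊆zs , ys⊆zs) =
        zs , zs↭ , dzs , zs⊆Ss , (λ { (here refl) → ys⊆zs R∈ys ; (there T∈) → Rs⊆zs T∈ }) , ys⊆zs ∘ old⊆

-- The correspondence

module _ {m : ℕ} {k : ℕ} where

  family : KTree k m → List (Matrix m)
  family (t , _) = List.map singleBlock (properClusters t)

  module _ (t : KTree k m) where

    ktree-unique : Unique (leaves (proj₁ t))
    ktree-unique = Unique-resp-↭ (↭-sym (proj₁ (proj₂ t))) (UniqueP.allFin⁺ m)

    ktree-branching : Branching (proj₁ t)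
    ktree-branching = DegOK⇒Branching k (proj₁ t) (proj₂ (proj₂ t))

    ktree-complete : ∀ i → i ∈ leaves (proj₁ t)
    ktree-complete i = ↭P.∈-resp-↭ (↭-sym (proj₁ (proj₂ t))) (∈P.∈-tabulate⁺ i)

    ktree-2≤∣∣ : ∀ {S} → S ∈ properClusters (proj₁ t) → 2 ≤ ∣ S ∣
    ktree-2≤∣∣ = properClusters-2≤∣∣ (proj₁ t) ktree-unique ktree-branching

  family-GFamily : ∀ t → GFamily k (family t)
  family-GFamily t@(t₀ , _ , dt) =
    ((InI-members , laminar⇒nested (properClusters t₀) (ktree-2≤∣∣ t) (properClusters-laminar t₀ (ktree-unique t))) , top∉) ,
    InG-members
    where
    InI-members : ∀ {x} → x ∈ family t → InI x
    InI-members x∈ with S , S∈ , refl ← ∈P.∈-map⁻ singleBlock x∈ = singleBlock-InI S (ktree-2≤∣∣ t S∈)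
    top∉ : ¬ top m ∈ family t
    top∉ top∈ with S , S∈ , top≡ ← ∈P.∈-map⁻ singleBlock top∈ =
      singleBlock≢top S (ktree-2≤∣∣ t S∈) (properClusters-proper t₀ (ktree-unique t) (ktree-branching t) S∈) (sym top≡)
    InG-members : ∀ {x} → x ∈ family t → InG k x
    InG-members x∈ with S , S∈ , refl ← ∈P.∈-map⁻ singleBlock x∈ =
      InI-members x∈ ,
      subst (k ∣_) (sym (rk-singleBlock S (2≤∣∣⇒∃∈S {S = S} (ktree-2≤∣∣ t S∈)))) (properClusters-k∣∣∣∸1 k t₀ (ktree-unique t) dt S∈)

  map-singleBlock-⊆⁻ : ∀ {Xs Ys : List (Subset m)} → (∀ {S} → S ∈ Xs → 2 ≤ ∣ S ∣) → (∀ {S} → S ∈ Ys → 2 ≤ ∣ S ∣) →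
                       List.map singleBlock Xs ⊆ₛ List.map singleBlock Ys → Xs ⊆ₛ Ys
  map-singleBlock-⊆⁻ largeX largeY Xs⊆Ys S∈ with S′ , S′∈ , e ← ∈P.∈-map⁻ singleBlock (Xs⊆Ys (∈P.∈-map⁺ singleBlock S∈)) =
    subst (_∈ _) (sym (singleBlock-injective (largeX S∈) (largeY S′∈) e)) S′∈

  family-⊆⁻ : ∀ t u → family t ⊆ₛ family u → properClusters (proj₁ t) ⊆ₛ properClusters (proj₁ u)
  family-⊆⁻ t u = map-singleBlock-⊆⁻ (ktree-2≤∣∣ t) (ktree-2≤∣∣ u)

  family-resp-≅ : ∀ t u → proj₁ t ≅ proj₁ u → family t ≋ₛ family u
  family-resp-≅ t u t≅u = ⊆P.map⁺ singleBlock (≅-properClusters t≅u) , ⊆P.map⁺ singleBlock (≅-properClusters (≅-sym t≅u))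

  family-reflects-≅ : ∀ t u → family t ≋ₛ family u → proj₁ t ≅ proj₁ u
  family-reflects-≅ t u (t⊆u , u⊆t) =
    ≅-from-clusters (proj₁ t) (proj₁ u) (ktree-unique t) (ktree-branching t) (ktree-unique u) (ktree-branching u)
      (λ {i} _ → ktree-complete u i) (λ {i} _ → ktree-complete t i) (family-⊆⁻ t u t⊆u) (family-⊆⁻ u t u⊆t)

  face⇒properClusters-⊆ : ∀ {t u : Tree m} → IsFace u t → properClusters u ⊆ₛ properClusters t
  face⇒properClusters-⊆ (v , t⇝⋆v , v≅u) = proj₂ (contractions-shrink t⇝⋆v) ∘ ≅-properClusters (≅-sym v≅u)

  -- Contracting every internal edge of t whose cluster is not a cluster of u yields u.
  properClusters-⊆⇒face : ∀ t u → properClusters (proj₁ u) ⊆ₛ properClusters (proj₁ t) → IsFace (proj₁ u) (proj₁ t)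
  properClusters-⊆⇒face t@(t₀ , _) u@(u₀ , _) u⊆t = contract t₀ , contract-reachable t₀ , contract-t≅u
    where
    open Contract (λ S → ⌊ Any.any? (S ≟S_) (properClusters u₀) ⌋)
    contract-t≅u : contract t₀ ≅ u₀
    contract-t≅u = ≅-from-clusters (contract t₀) u₀
      (subst Unique (sym (contract-leaves t₀)) (ktree-unique t)) (contract-Branching t₀ (ktree-branching t))
      (ktree-unique u) (ktree-branching u)
      (λ {i} _ → ktree-complete u i) (λ {i} _ → subst (i ∈_) (sym (contract-leaves t₀)) (ktree-complete t i))
      (λ S∈ → witness⌊⌋ (Any.any? (_ ≟S_) (properClusters u₀)) (proj₂ (∈-properClusters-contract⁻ t₀ S∈)))
      (λ S∈ → ∈-properClusters-contract⁺ t₀ (u⊆t S∈) (⌊⌋≡true (Any.any? (_ ≟S_) (properClusters u₀)) S∈))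

  face⇔family-⊆ : ∀ t u → IsFace (proj₁ u) (proj₁ t) ⇔ (family u ⊆ₛ family t)
  face⇔family-⊆ t u = mk⇔ (⊆P.map⁺ singleBlock ∘ face⇒properClusters-⊆)
                          (properClusters-⊆⇒face t u ∘ family-⊆⁻ u t)

  GFamily-downward-closed : ∀ (N N′ : List (Matrix m)) → GFamily k N → N′ ⊆ₛ N → GFamily k N′
  GFamily-downward-closed N N′ (((InI-N , nested) , top∉) , InG-N) N′⊆N =
    (((InI-N ∘ N′⊆N) , (λ xs xs⊆ → nested xs (N′⊆N ∘ xs⊆))) , top∉ ∘ N′⊆N) , InG-N ∘ N′⊆N

InI-impossible : ∀ (x : Matrix 1) → ¬ InI x
InI-impossible x (_ , (i , 1<∣∣) , _) = ℕP.<⇒≱ 1<∣∣ (∣p∣≤n (block x i))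

star : ∀ m → List (Tree m)
star m = List.map leaf (allFin m)

leavesL-star : ∀ m → leavesL (star m) ≡ allFin m
leavesL-star m = go (allFin m)
  where
  go : ∀ (is : List (Fin m)) → leavesL (List.map leaf is) ≡ is
  go [] = refl
  go (i ∷ is) = cong (i ∷_) (go is)

clustersL-star : ∀ m → clustersL (star m) ≡ []
clustersL-star m = go (allFin m)
  where
  go : ∀ (is : List (Fin m)) → clustersL (List.map leaf is) ≡ []
  go [] = refl
  go (_ ∷ is) = go is

DegOK-star : ∀ k m → 1 < m → k ∣ m ∸ 1 → DegOK k (node (star m))
DegOK-star k m 1<m k∣m∸1 =
  subst (1 <_) (sym length-star) 1<m , subst (λ n → k ∣ n ∸ 1) (sym length-star) k∣m∸1 , go (allFin m)
  where
  length-star : length (star m) ≡ m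
  length-star = trans (ListP.length-map leaf (allFin m)) (ListP.length-tabulate id)
  go : ∀ (is : List (Fin m)) → DegOKL k (List.map leaf is)
  go [] = tt
  go (_ ∷ is) = tt , go is

InI-list⇒singleBlocks : ∀ {m} (N : List (Matrix m)) → (∀ {x} → x ∈ N → InI x) →
                        ∃[ Ss ] (List.map singleBlock Ss ≡ N × (∀ {S} → S ∈ Ss → 2 ≤ ∣ S ∣))
InI-list⇒singleBlocks [] _ = [] , refl , λ ()
InI-list⇒singleBlocks (x ∷ N) InI-N
  with S , refl , 2≤∣S∣ ← InI⇒singleBlock x (InI-N (here refl)) | Ss , refl , large ← InI-list⇒singleBlocks N (InI-N ∘ there) =
  S ∷ Ss , refl , λ { (here refl) → 2≤∣S∣ ; (there S∈) → large S∈ }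

singleBlocks-realizable : ∀ {k} m → 1 < m → k ∣ m ∸ 1 → (Ss : List (Subset m)) → (∀ {S} → S ∈ Ss → 2 ≤ ∣ S ∣) →
                          GFamily k (List.map singleBlock Ss) → ∃[ t ] (family {k = k} t ≋ₛ List.map singleBlock Ss)
singleBlocks-realizable {k} m 1<m k∣m∸1 Ss large (((InI-N , nested) , top∉) , InG-N) =
  realize (Realization.insertAll k Ss large k∣ proper laminar Ss id (star m)
             (↭.↭-reflexive (leavesL-star m)) (DegOK-star k m 1<m k∣m∸1) (⊥-elim ∘ ¬Any[] ∘ subst (_ ∈_) (clustersL-star m)))
  where
  k∣ : ∀ {S} → S ∈ Ss → k ∣ ∣ S ∣ ∸ 1
  k∣ {S} S∈ = subst (k ∣_) (rk-singleBlock S (2≤∣∣⇒∃∈S {S = S} (large S∈))) (proj₂ (InG-N (∈P.∈-map⁺ singleBlock S∈)))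
  proper : ∀ {S} → S ∈ Ss → ∃[ i ] (¬ i ∈S S)
  proper {S} S∈ = FinP.¬∀⟶∃¬ m (_∈S S) (_∈S? S) λ all∈S →
    top∉ (subst (_∈ _) (Matrix-ext (singleBlock S) (top m) λ i j →
      trans (rel-singleBlock⁺ S (inj₂ (all∈S i , all∈S j))) (sym (rel-top i j))) (∈P.∈-map⁺ singleBlock S∈))
  laminar : Laminar Ss
  laminar {S} {T} S∈ T∈ = nested⇒laminar _ (InI-N , nested) {S = S} {T = T}
    (∈P.∈-map⁺ singleBlock S∈) (∈P.∈-map⁺ singleBlock T∈) (large S∈) (large T∈)
  realize : Realization.Realized k Ss large k∣ proper laminar Ss (star m) →
            ∃[ t ] (family {k = k} t ≋ₛ List.map singleBlock Ss)
  realize (ys , ys↭ , dys , ys⊆Ss , Ss⊆ys , _) =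
    (node ys , ys↭ , dys) , ⊆P.map⁺ singleBlock ys⊆Ss , ⊆P.map⁺ singleBlock Ss⊆ys

family-surjective : ∀ {k} m → 1 ≤ m → k ∣ m ∸ 1 → ∀ (N : List (Matrix m)) → GFamily k N → ∃[ t ] (family {k = k} t ≋ₛ N)
family-surjective (suc zero) _ _ N (((InI-N , _) , _) , _) =
  (leaf zero , ↭-refl , tt) , (λ ()) , λ {x} x∈ → contradiction (InI-N x∈) (InI-impossible x)
family-surjective m@(suc (suc _)) _ k∣m∸1 N G@(((InI-N , _) , _) , _)
  with Ss , refl , large ← InI-list⇒singleBlocks N InI-N =
  singleBlocks-realizable m (s≤s (s≤s z≤n)) k∣m∸1 Ss large G

mainTheorem2 : (k n : ℕ) → 1 ≤ k → 1 ≤ n →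
    Σ (KTree k ((n ∸ 1) * k + 1) → List (Matrix ((n ∸ 1) * k + 1))) (λ f →
      (∀ t → GFamily k (f t)) ×
      (∀ t t' → proj₁ t ≅ proj₁ t' → f t ≋ₛ f t') ×
      (∀ t t' → f t ≋ₛ f t' → proj₁ t ≅ proj₁ t') ×
      (∀ N → GFamily k N → ∃[ t ] (f t ≋ₛ N)) ×
      (∀ t₁ t₂ → IsFace (proj₁ t₂) (proj₁ t₁) ⇔ (f t₂ ⊆ₛ f t₁))) ×
    (∀ (N N' : List (Matrix ((n ∸ 1) * k + 1))) →
      GFamily k N → N' ⊆ₛ N → GFamily k N')
mainTheorem2 k n _ _ =
  (family , family-GFamily , family-resp-≅ , family-reflects-≅ , family-surjective m 1≤m k∣m∸1 , face⇔family-⊆) ,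
  GFamily-downward-closed
  where
  m = (n ∸ 1) * k + 1
  1≤m : 1 ≤ m
  1≤m = ℕP.m≤n+m 1 ((n ∸ 1) * k)
  k∣m∸1 : k ∣ m ∸ 1
  k∣m∸1 = subst (k ∣_) (sym (ℕP.m+n∸n≡m ((n ∸ 1) * k) 1)) (n∣m*n (n ∸ 1))
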